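{- Let $X$ be a maximal set of mutually non-opposite chambers of $\mathrm{PG}(3,q)$ and let $\ell$ be a line. Then: (a) at most $(q+1)^3$ chambers $(Q,h,\tau)$ of $X$ satisfy $Q\in\ell\subseteq\tau$; (b) at most $(q+1)q^2$ chambers $(Q,h,\tau)$ of $X$ satisfy $Q\notin\ell$ and $\ell\subseteq\tau$; (c) at most $(q+1)q^2$ chambers $(Q,h,\tau)$ of $X$ satisfy $Q\in\ell$ and $\ell\not\subseteq\tau$.
   Context: A chamber of $\mathrm{PG}(3,q)$ is a triple $(P,\ell,\pi)$ of a point $P$, a line $\ell$ and a plane $\pi$ that are pairwise incident. Chambers $(P,\ell,\pi)$ and $(P',\ell',\pi')$ are opposite if $P\notin\pi'$, $\ell\cap\ell'=\emptyset$ and $P'\notin\pi$. Maximal means maximal with respect to inclusion among sets of pairwise non-opposite chambers. -}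

module Defs where

open import Level using (0ℓ)
open import Data.Nat using (ℕ; _≤_)
open import Data.Fin using (Fin; zero; suc)
open import Data.Product using (Σ; ∃; _×_; _,_)
open import Data.List using (List; length)
open import Data.List.Relation.Unary.All using (All)
open import Data.List.Relation.Unary.AllPairs using (AllPairs)
open import Relation.Nullary using (¬_)
open import Relation.Binary.Definitions using (Decidable)
open import Relation.Binary.PropositionalEquality using (_≡_)
open import Algebra.Bundles using (CommutativeRing)

record FiniteField (q : ℕ) : Set₁ where
  field
    commRing : CommutativeRing 0ℓ 0ℓ
  open CommutativeRing commRing public
  field
    _≟_      : Decidable _≈_
    0≉1      : ¬ (0# ≈ 1#)
    inverse  : ∀ x → ¬ (x ≈ 0#) → ∃ λ y → x * y ≈ 1#
    enum     : Fin q → Carrier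
    enum-inj : ∀ i j → enum i ≈ enum j → i ≡ j
    enum-sur : ∀ x → ∃ λ i → enum i ≈ x

-- The projective space PG(3,q) = PG(F^4), with subspaces given by representatives.
module PG3 {q : ℕ} (F : FiniteField q) where
  open FiniteField F using (Carrier; _≈_; _+_; _*_; 0#)

  V : Set
  V = Fin 4 → Carrier

  IsZero : V → Set
  IsZero w = ∀ i → w i ≈ 0#

  dot : V → V → Carrier
  dot a w = a zero * w zero + (a (suc zero) * w (suc zero)
          + (a (suc (suc zero)) * w (suc (suc zero))
          + a (suc (suc (suc zero))) * w (suc (suc (suc zero)))))

  record Point : Set where
    constructor point
    field
      vec    : V
      vec≠0  : ¬ IsZero vec

  -- a plane: 3-dimensional subspace, the kernel of a nonzero linear form
  record Plane : Set where
    constructor plane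
    field
      form   : V
      form≠0 : ¬ IsZero form

  record Line : Set where
    constructor line
    field
      u v   : V
      indep : ∀ a b → IsZero (λ i → a * u i + b * v i) → (a ≈ 0#) × (b ≈ 0#)

  InSpan : V → Line → Set
  InSpan w ℓ = ∃ λ a → ∃ λ b → ∀ i → w i ≈ a * Line.u ℓ i + b * Line.v ℓ i

  _≈ₚ_ : Point → Point → Set
  P ≈ₚ P' = ∃ λ c → ∀ i → Point.vec P i ≈ c * Point.vec P' i

  _≈π_ : Plane → Plane → Set
  π ≈π π' = ∃ λ c → ∀ i → Plane.form π i ≈ c * Plane.form π' i

  _≈ₗ_ : Line → Line → Set
  ℓ ≈ₗ ℓ' = (InSpan (Line.u ℓ) ℓ' × InSpan (Line.v ℓ) ℓ')
          × (InSpan (Line.u ℓ') ℓ × InSpan (Line.v ℓ') ℓ)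

  _∈ₗ_ : Point → Line → Set
  P ∈ₗ ℓ = InSpan (Point.vec P) ℓ

  _∈π_ : Point → Plane → Set
  P ∈π π = dot (Plane.form π) (Point.vec P) ≈ 0#

  _⊆π_ : Line → Plane → Set
  ℓ ⊆π π = (dot (Plane.form π) (Line.u ℓ) ≈ 0#) × (dot (Plane.form π) (Line.v ℓ) ≈ 0#)

  Disjoint : Line → Line → Set
  Disjoint ℓ ℓ' = ∀ w → InSpan w ℓ → InSpan w ℓ' → IsZero w

  record Chamber : Set where
    constructor chamber
    field
      pt   : Point
      ln   : Line
      pl   : Plane
      pt∈ln : pt ∈ₗ ln
      ln⊆pl : ln ⊆π pl

  open Chamber public

  _≈ᶜ_ : Chamber → Chamber → Set
  C ≈ᶜ D = (pt C ≈ₚ pt D) × (ln C ≈ₗ ln D) × (pl C ≈π pl D)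

  Opposite : Chamber → Chamber → Set
  Opposite C D = ¬ (pt C ∈π pl D) × Disjoint (ln C) (ln D) × ¬ (pt D ∈π pl C)

  PairwiseNonOpposite : (Chamber → Set) → Set
  PairwiseNonOpposite Y = ∀ C D → Y C → Y D → ¬ Opposite C D

  Maximal : (Chamber → Set) → Set₁
  Maximal X = PairwiseNonOpposite X
            × (∀ (Y : Chamber → Set) → (∀ C → X C → Y C) → PairwiseNonOpposite Y
               → ∀ C → Y C → X C)

  -- "at most N chambers of X satisfy R": every list of pairwise distinct chambers
  -- of X satisfying R has length at most N
  AtMost : ℕ → (Chamber → Set) → (Chamber → Set) → Set
  AtMost N X R = ∀ (cs : List Chamber) → All X cs → All R cs
               → AllPairs (λ C D → ¬ (C ≈ᶜ D)) cs → length cs ≤ N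

module Submission where

-- After a linear change of coordinates ℓ is the line L₀ = ⟨e₀, e₁⟩, and every bound comes from a
-- code of the chambers in question into a finite set that is injective up to equality of flags.
-- (a) Q ∈ L₀ ⊆ τ: the chamber is fixed by Q ∈ L₀, by τ ⊇ L₀ and by the line h of τ through Q,
--     with q + 1 choices each.
-- (b) Q ∉ L₀ ⊆ τ: if all chambers of X share the plane τ, a chamber is fixed by Q ∈ τ ∖ L₀ (q²
--     choices) and the point h ∩ L₀ (q + 1). Otherwise take two chambers with different planes: their
--     lines must meet on L₀, or the chambers would be opposite, and every further chamber has a
--     plane different from one of theirs; so all lines h pass through one point R of L₀ and a chamber
--     is fixed by Q ∉ L₀ ((q + 1) q² choices).
-- (c) Q ∈ L₀ ⊈ τ is dual: either all chambers share the point Q, or all lines h lie in one plane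
--     through L₀; a chamber is then fixed by τ ⊉ L₀ together with the direction of h, respectively
--     by τ alone.

open import Defs
open import Algebra.Bundles using (CommutativeRing)
open import Algebra.Solver.Ring.AlmostCommutativeRing
  using (fromCommutativeRing; _-Raw-AlmostCommutative⟶_)
open import Data.Empty using (⊥-elim)
open import Data.Fin as Fin using (Fin)
import Data.Fin.Properties as FinP
open import Data.Fin.Permutation.Components using (transpose; transpose-inverse)
open import Data.Integer as ℤ using (ℤ; +_; -[1+_]; _⊖_)
import Data.Integer.Properties as ℤP
open import Data.List using ([]; _∷_; length; lookup; map)
import Data.List.Properties as ListP
open import Data.List.Relation.Unary.All as All using (All; []; _∷_)
import Data.List.Relation.Unary.All.Properties as AllP
open import Data.List.Relation.Unary.AllPairs as AllPairs using (AllPairs; []; _∷_)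
import Data.List.Relation.Unary.AllPairs.Properties as AllPairsP
open import Data.Maybe using (Maybe; just; nothing)
open import Data.Nat as ℕ using (ℕ; zero; suc; _≤_)
import Data.Nat.Properties as ℕP
open import Data.Product using (Σ; ∃; _×_; _,_; proj₁; proj₂)
open import Relation.Nullary using (¬_; Dec; yes; no; _×-dec_)
open import Relation.Nullary.Negation using (¬¬-map)
open import Relation.Nullary.Decidable using (decidable-stable; ¬¬-excluded-middle; dec-true; dec-false)
open import Relation.Binary.PropositionalEquality as ≡ using (_≡_; _≢_)

-- Ring solver with integer coefficients for an arbitrary commutative ring

module IntegerCoefficientSolver {c ℓ} (R : CommutativeRing c ℓ) where
  open CommutativeRing R
  open import Algebra.Properties.Ring ring using (-‿involutive; -0#≈0#; -‿+-comm; -‿distribˡ-*; -‿distribʳ-*)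
  open import Algebra.Properties.Semiring.Mult.TCOptimised semiring using (1+×; ×-homo-+; ×1-homo-*)
    renaming (_×_ to _×′_)
  open import Relation.Binary.Reasoning.Setoid setoid

  ⟦_⟧ : ℤ → Carrier
  ⟦ + n ⟧ = n ×′ 1#
  ⟦ -[1+ n ] ⟧ = - (suc n ×′ 1#)

  ⟦-⟧ : ∀ i → ⟦ ℤ.- i ⟧ ≈ - ⟦ i ⟧
  ⟦-⟧ (+ zero) = sym -0#≈0#
  ⟦-⟧ (+ suc n) = refl
  ⟦-⟧ -[1+ n ] = sym (-‿involutive _)

  1+a-[1+b]≈a-b : ∀ a b → (1# + a) + - (1# + b) ≈ a + - b
  1+a-[1+b]≈a-b a b = begin
    (1# + a) + - (1# + b)    ≈⟨ +-congˡ (sym (-‿+-comm 1# b)) ⟩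
    (1# + a) + (- 1# + - b)  ≈⟨ +-assoc 1# a _ ⟩
    1# + (a + (- 1# + - b))  ≈⟨ +-congˡ (trans (sym (+-assoc a _ _)) (+-congʳ (+-comm a _))) ⟩
    1# + ((- 1# + a) + - b)  ≈⟨ trans (+-congˡ (+-assoc _ a _)) (sym (+-assoc 1# _ _)) ⟩
    (1# + - 1#) + (a + - b)  ≈⟨ trans (+-congʳ (-‿inverseʳ 1#)) (+-identityˡ _) ⟩
    a + - b                  ∎

  ⟦⊖⟧ : ∀ m n → ⟦ m ⊖ n ⟧ ≈ ⟦ + m ⟧ + - ⟦ + n ⟧
  ⟦⊖⟧ m zero = sym (trans (+-congˡ -0#≈0#) (+-identityʳ _))
  ⟦⊖⟧ zero (suc n) = sym (+-identityˡ _)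
  ⟦⊖⟧ (suc m) (suc n) = begin
    ⟦ suc m ⊖ suc n ⟧                      ≡⟨ ≡.cong ⟦_⟧ (ℤP.[1+m]⊖[1+n]≡m⊖n m n) ⟩
    ⟦ m ⊖ n ⟧                              ≈⟨ ⟦⊖⟧ m n ⟩
    m ×′ 1# + - (n ×′ 1#)                    ≈⟨ 1+a-[1+b]≈a-b _ _ ⟨
    (1# + m ×′ 1#) + - (1# + n ×′ 1#)        ≈⟨ +-cong (1+× m 1#) (-‿cong (1+× n 1#)) ⟨
    suc m ×′ 1# + - (suc n ×′ 1#)            ∎

  ⟦+⟧ : ∀ i j → ⟦ i ℤ.+ j ⟧ ≈ ⟦ i ⟧ + ⟦ j ⟧
  ⟦+⟧ (+ m) (+ n) = ×-homo-+ 1# m n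
  ⟦+⟧ (+ m) -[1+ n ] = ⟦⊖⟧ m (suc n)
  ⟦+⟧ -[1+ m ] (+ n) = trans (⟦⊖⟧ n (suc m)) (+-comm _ _)
  ⟦+⟧ -[1+ m ] -[1+ n ] = begin
    - (suc (suc (m ℕ.+ n)) ×′ 1#)        ≡⟨ ≡.cong (λ k → - (suc k ×′ 1#)) (≡.sym (ℕP.+-suc m n)) ⟩
    - ((suc m ℕ.+ suc n) ×′ 1#)          ≈⟨ -‿cong (×-homo-+ 1# (suc m) (suc n)) ⟩
    - (suc m ×′ 1# + suc n ×′ 1#)         ≈⟨ -‿+-comm _ _ ⟨
    - (suc m ×′ 1#) + - (suc n ×′ 1#)     ∎

  ⟦*⟧⁺ : ∀ m n → ⟦ + m ℤ.* + n ⟧ ≈ ⟦ + m ⟧ * ⟦ + n ⟧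
  ⟦*⟧⁺ m n = trans (reflexive (≡.cong ⟦_⟧ (≡.sym (ℤP.pos-* m n)))) (×1-homo-* m n)

  ⟦*⟧ : ∀ i j → ⟦ i ℤ.* j ⟧ ≈ ⟦ i ⟧ * ⟦ j ⟧
  ⟦*⟧ (+ m) (+ n) = ⟦*⟧⁺ m n
  ⟦*⟧ (+ m) -[1+ n ] = begin
    ⟦ + m ℤ.* ℤ.- + suc n ⟧      ≡⟨ ≡.cong ⟦_⟧ (≡.sym (ℤP.neg-distribʳ-* (+ m) (+ suc n))) ⟩
    ⟦ ℤ.- (+ m ℤ.* + suc n) ⟧    ≈⟨ ⟦-⟧ (+ m ℤ.* + suc n) ⟩
    - ⟦ + m ℤ.* + suc n ⟧        ≈⟨ -‿cong (⟦*⟧⁺ m (suc n)) ⟩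
    - (⟦ + m ⟧ * ⟦ + suc n ⟧)    ≈⟨ -‿distribʳ-* _ _ ⟩
    ⟦ + m ⟧ * - ⟦ + suc n ⟧      ∎
  ⟦*⟧ -[1+ m ] (+ n) = begin
    ⟦ ℤ.- + suc m ℤ.* + n ⟧      ≡⟨ ≡.cong ⟦_⟧ (≡.sym (ℤP.neg-distribˡ-* (+ suc m) (+ n))) ⟩
    ⟦ ℤ.- (+ suc m ℤ.* + n) ⟧    ≈⟨ ⟦-⟧ (+ suc m ℤ.* + n) ⟩
    - ⟦ + suc m ℤ.* + n ⟧        ≈⟨ -‿cong (⟦*⟧⁺ (suc m) n) ⟩
    - (⟦ + suc m ⟧ * ⟦ + n ⟧)    ≈⟨ -‿distribˡ-* _ _ ⟩
    - ⟦ + suc m ⟧ * ⟦ + n ⟧      ∎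
  ⟦*⟧ -[1+ m ] -[1+ n ] = begin
    ⟦ ℤ.- + suc m ℤ.* ℤ.- + suc n ⟧    ≡⟨ ≡.cong ⟦_⟧ -a*-b≡a*b ⟩
    ⟦ + suc m ℤ.* + suc n ⟧            ≈⟨ ⟦*⟧⁺ (suc m) (suc n) ⟩
    ⟦ + suc m ⟧ * ⟦ + suc n ⟧          ≈⟨ -‿involutive _ ⟨
    - - (⟦ + suc m ⟧ * ⟦ + suc n ⟧)    ≈⟨ trans (-‿cong (-‿distribʳ-* _ _)) (-‿distribˡ-* _ _) ⟩
    - ⟦ + suc m ⟧ * - ⟦ + suc n ⟧      ∎
    where
    a = + suc m
    b = + suc n
    -a*-b≡a*b : ℤ.- a ℤ.* ℤ.- b ≡ a ℤ.* b
    -a*-b≡a*b = ≡.trans (≡.sym (ℤP.neg-distribˡ-* a (ℤ.- b)))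
      (≡.trans (≡.cong ℤ.-_ (≡.sym (ℤP.neg-distribʳ-* a b))) (ℤP.neg-involutive (a ℤ.* b)))

  ℤ⟶R : ℤ.+-*-rawRing -Raw-AlmostCommutative⟶ fromCommutativeRing R
  ℤ⟶R = record
    { ⟦_⟧ = ⟦_⟧ ; +-homo = ⟦+⟧ ; *-homo = ⟦*⟧ ; -‿homo = ⟦-⟧ ; 0-homo = refl ; 1-homo = refl }

  ⟦⟧-≟ : ∀ i j → Maybe (⟦ i ⟧ ≈ ⟦ j ⟧)
  ⟦⟧-≟ i j with i ℤ.≟ j
  ... | yes ≡.refl = just refl
  ... | no _ = nothing

  open import Algebra.Solver.Ring ℤ.+-*-rawRing (fromCommutativeRing R) ℤ⟶R ⟦⟧-≟ public
    using (solve; _:=_; _:+_; _:*_; :-_; con)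

-- Counting

module _ {A : Set} where

  all-lookupᶠ : ∀ {P : A → Set} {xs} → All P xs → (i : Fin (length xs)) → P (lookup xs i)
  all-lookupᶠ (px ∷ _) Fin.zero = px
  all-lookupᶠ (_ ∷ pxs) (Fin.suc i) = all-lookupᶠ pxs i

  allPairs-lookupᶠ : ∀ {R : A → A → Set} {xs} → AllPairs R xs →
    ∀ (i j : Fin (length xs)) → i Fin.< j → R (lookup xs i) (lookup xs j)
  allPairs-lookupᶠ (rx ∷ _) Fin.zero (Fin.suc j) _ = all-lookupᶠ rx j
  allPairs-lookupᶠ (_ ∷ rxs) (Fin.suc i) (Fin.suc j) (ℕ.s≤s i<j) = allPairs-lookupᶠ rxs i j i<j

  length≤-by-code : ∀ {_~_ : A → A → Set} {S : A → Set} {n} (code : ∀ x → S x → Fin n) →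
    (∀ x y (s : S x) (t : S y) → code x s ≡ code y t → x ~ y) →
    ∀ xs → All S xs → AllPairs (λ x y → ¬ (x ~ y)) xs → length xs ≤ n
  length≤-by-code {n = n} code code-injective xs sxs distinct with length xs ℕP.≤? n
  ... | yes ≤n = ≤n
  ... | no ≰n with i , j , i<j , same ← FinP.pigeonhole (ℕP.≰⇒> ≰n) (λ k → code (lookup xs k) (all-lookupᶠ sxs k))
    = ⊥-elim (allPairs-lookupᶠ distinct i j i<j (code-injective _ _ _ _ same))

  ¬¬-all : ∀ {P : A → Set} {xs} → All (λ x → ¬ ¬ P x) xs → ¬ ¬ All P xs
  ¬¬-all [] k = k []
  ¬¬-all (¬¬p ∷ ¬¬ps) k = ¬¬p λ p → ¬¬-all ¬¬ps λ ps → k (p ∷ ps)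

  ¬all⇒¬¬∃¬ : ∀ {T P : A → Set} {xs} → All T xs → ¬ All P xs → ¬ ¬ (∃ λ x → T x × ¬ P x)
  ¬all⇒¬¬∃¬ ts ¬all k = ¬¬-all (All.map (λ t ¬p → k (_ , t , ¬p)) ts) ¬all

  -- Either every element is ≈ to the head x, or some y is not; then Ψ x y, and Ψ x z follows for every z
  -- by spreading from x or from y, whichever z is not ≈ to. The case split is classical, which is
  -- harmless as the conclusion is decidable.
  length≤-by-dichotomy : ∀ {_~_ : A → A → Set} {n} (T : A → Set) (_≈_ : A → A → Set) →
    (∀ {x y} → x ≈ y → y ≈ x) → (∀ {x y z} → x ≈ y → y ≈ z → x ≈ z) →
    (Ψ : A → A → Set) → (∀ {x} → T x → Ψ x x) →
    (∀ {x y z} → T x → T y → T z → ¬ (y ≈ z) → Ψ x y → ¬ ¬ Ψ x z) →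
    (∀ x → T x → ∀ ys → All (λ y → T y × y ≈ x) ys → AllPairs (λ y z → ¬ (y ~ z)) ys → length ys ≤ n) →
    (∀ x → T x → ∀ ys → All (λ y → T y × Ψ x y) ys → AllPairs (λ y z → ¬ (y ~ z)) ys → length ys ≤ n) →
    ∀ xs → All T xs → AllPairs (λ y z → ¬ (y ~ z)) xs → length xs ≤ n
  length≤-by-dichotomy T _≈_ ≈-sym ≈-trans Ψ Ψ-refl Ψ-spread bound-≈ bound-Ψ [] _ _ = ℕ.z≤n
  length≤-by-dichotomy {n = n} T _≈_ ≈-sym ≈-trans Ψ Ψ-refl Ψ-spread bound-≈ bound-Ψ
    xs@(x ∷ _) ts@(tx ∷ _) distinct =
    decidable-stable (length xs ℕP.≤? n) λ ≰n → ¬¬-excluded-middle λ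
      { (yes all≈) → ≰n (bound-≈ x tx xs (All.zip (ts , all≈)) distinct)
      ; (no ¬all≈) → ¬all⇒¬¬∃¬ ts ¬all≈ λ { (y , ty , y≉x) →
          Ψ-spread tx tx ty (λ x≈y → y≉x (≈-sym x≈y)) (Ψ-refl tx) λ Ψxy →
          ¬¬-all (All.map (spread ty y≉x Ψxy) ts) λ allΨ →
          ≰n (bound-Ψ x tx xs (All.zip (ts , allΨ)) distinct) } }
    where
    spread : ∀ {y} → T y → ¬ (y ≈ x) → Ψ x y → ∀ {z} → T z → ¬ ¬ Ψ x z
    spread {y} ty y≉x Ψxy {z} tz ¬Ψxz = ¬¬-excluded-middle λ
      { (yes z≈x) → Ψ-spread tx ty tz (λ y≈z → y≉x (≈-trans y≈z z≈x)) Ψxy ¬Ψxz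
      ; (no z≉x) → Ψ-spread tx tx tz (λ x≈z → z≉x (≈-sym x≈z)) (Ψ-refl tx) ¬Ψxz }

length≤-via-map : ∀ {A B : Set} {_~_ : A → A → Set} {_≈_ : B → B → Set} {R : A → Set} {R' : B → Set} {n}
  (f : A → B) → (∀ {x y} → f x ≈ f y → x ~ y) → (∀ {x} → R x → R' (f x)) →
  (∀ ys → All R' ys → AllPairs (λ x y → ¬ (x ≈ y)) ys → length ys ≤ n) →
  ∀ xs → All R xs → AllPairs (λ x y → ¬ (x ~ y)) xs → length xs ≤ n
length≤-via-map {n = n} f reflect preserve bound xs rxs distinct = ≡.subst (_≤ n) (ListP.length-map f xs)
  (bound (map f xs) (AllP.map⁺ (All.map preserve rxs))
    (AllPairsP.map⁺ (AllPairs.map (λ x≁y fx≈fy → x≁y (reflect fx≈fy)) distinct)))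

module _ {q : ℕ} (F : FiniteField q) where
  open FiniteField F
  open PG3 F
  open IntegerCoefficientSolver commRing using (solve; _:=_; _:+_; _:*_; :-_; con)
  open import Algebra.Properties.Ring ring using (-‿involutive; -0#≈0#; -‿distribˡ-*)
  open import Relation.Binary.Reasoning.Setoid setoid

  _⁻¹ : Carrier → Carrier
  x ⁻¹ with x ≟ 0#
  ... | yes _ = 0#
  ... | no x≉0 = proj₁ (inverse x x≉0)

  x*x⁻¹≈1 : ∀ {x} → x ≉ 0# → x * x ⁻¹ ≈ 1#
  x*x⁻¹≈1 {x} x≉0 with x ≟ 0#
  ... | yes x≈0 = ⊥-elim (x≉0 x≈0)
  ... | no x≉0′ = proj₂ (inverse x x≉0′)

  x⁻¹*x≈1 : ∀ {x} → x ≉ 0# → x ⁻¹ * x ≈ 1#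
  x⁻¹*x≈1 x≉0 = trans (*-comm _ _) (x*x⁻¹≈1 x≉0)

  x⁻¹*[x*y]≈y : ∀ {x} y → x ≉ 0# → x ⁻¹ * (x * y) ≈ y
  x⁻¹*[x*y]≈y {x} y x≉0 = trans (sym (*-assoc _ _ _)) (trans (*-congʳ (x⁻¹*x≈1 x≉0)) (*-identityˡ y))

  1≉0 : 1# ≉ 0#
  1≉0 1≈0 = 0≉1 (sym 1≈0)

  x*y≈0⇒x≈0 : ∀ {x y} → y ≉ 0# → x * y ≈ 0# → x ≈ 0#
  x*y≈0⇒x≈0 {x} {y} y≉0 xy≈0 = begin
    x                 ≈⟨ sym (*-identityʳ x) ⟩
    x * 1#            ≈⟨ *-congˡ (sym (x*x⁻¹≈1 y≉0)) ⟩
    x * (y * y ⁻¹)    ≈⟨ sym (*-assoc _ _ _) ⟩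
    (x * y) * y ⁻¹    ≈⟨ *-congʳ xy≈0 ⟩
    0# * y ⁻¹         ≈⟨ zeroˡ _ ⟩
    0#                ∎

  x*y≈0⇒y≈0 : ∀ {x y} → x ≉ 0# → x * y ≈ 0# → y ≈ 0#
  x*y≈0⇒y≈0 x≉0 xy≈0 = x*y≈0⇒x≈0 x≉0 (trans (*-comm _ _) xy≈0)

  *-≉0 : ∀ {x y} → x ≉ 0# → y ≉ 0# → x * y ≉ 0#
  *-≉0 x≉0 y≉0 xy≈0 = x≉0 (x*y≈0⇒x≈0 y≉0 xy≈0)

  *-cancelˡ : ∀ {x a b} → x ≉ 0# → x * a ≈ x * b → a ≈ b
  *-cancelˡ {x} {a} {b} x≉0 xa≈xb = begin
    a                 ≈⟨ sym (x⁻¹*[x*y]≈y a x≉0) ⟩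
    x ⁻¹ * (x * a)    ≈⟨ *-congˡ xa≈xb ⟩
    x ⁻¹ * (x * b)    ≈⟨ x⁻¹*[x*y]≈y b x≉0 ⟩
    b                 ∎

  x-y≈0⇒x≈y : ∀ {x y} → x + - y ≈ 0# → x ≈ y
  x-y≈0⇒x≈y {x} {y} x-y≈0 = begin
    x                 ≈⟨ solve 2 (λ x y → x := (x :+ :- y) :+ y) refl x y ⟩
    (x + - y) + y     ≈⟨ +-congʳ x-y≈0 ⟩
    0# + y            ≈⟨ +-identityˡ y ⟩
    y                 ∎

  x≈y⇒x-y≈0 : ∀ {x y} → x ≈ y → x + - y ≈ 0#
  x≈y⇒x-y≈0 x≈y = trans (+-congʳ x≈y) (-‿inverseʳ _)

  x*0+y*0≈0 : ∀ x y → x * 0# + y * 0# ≈ 0#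
  x*0+y*0≈0 x y = trans (+-cong (zeroʳ x) (zeroʳ y)) (+-identityʳ 0#)

  x/s≈x'/s'⇒x≈l*x' : ∀ {s s' l x x'} → s ≉ 0# → s' ≉ 0# → s ≈ l * s' →
    x * s ⁻¹ ≈ x' * s' ⁻¹ → x ≈ l * x'
  x/s≈x'/s'⇒x≈l*x' {s} {s'} {l} {x} {x'} s≉0 s'≉0 s≈ls' quotients≈ = begin
    x                        ≈⟨ sym (*-identityʳ x) ⟩
    x * 1#                   ≈⟨ *-congˡ (sym (x⁻¹*x≈1 s≉0)) ⟩
    x * (s ⁻¹ * s)           ≈⟨ sym (*-assoc _ _ _) ⟩
    x * s ⁻¹ * s             ≈⟨ *-cong quotients≈ s≈ls' ⟩
    x' * s' ⁻¹ * (l * s')    ≈⟨ solve 4 (λ x t l s → x :* t :* (l :* s) := l :* x :* (t :* s)) refl x' (s' ⁻¹) l s' ⟩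
    l * x' * (s' ⁻¹ * s')    ≈⟨ *-congˡ (x⁻¹*x≈1 s'≉0) ⟩
    l * x' * 1#              ≈⟨ *-identityʳ _ ⟩
    l * x'                   ∎

  index : Carrier → Fin q
  index x = proj₁ (enum-sur x)

  index-injective : ∀ {x y} → index x ≡ index y → x ≈ y
  index-injective {x} {y} same =
    trans (sym (proj₂ (enum-sur x))) (trans (reflexive (≡.cong enum same)) (proj₂ (enum-sur y)))

  -- Linear algebra in F⁴

  infix 4 _≐_
  _≐_ : V → V → Set
  x ≐ y = ∀ i → x i ≈ y i

  ≐-trans : ∀ {x y z} → x ≐ y → y ≐ z → x ≐ z
  ≐-trans x≐y y≐z i = trans (x≐y i) (y≐z i)

  ≐-sym : ∀ {x y} → x ≐ y → y ≐ x
  ≐-sym x≐y i = sym (x≐y i)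

  0v : V
  0v _ = 0#

  lc : Carrier → V → Carrier → V → V
  lc a x b y i = a * x i + b * y i

  lc-congʳ : ∀ a x b {y y'} → y ≐ y' → lc a x b y ≐ lc a x b y'
  lc-congʳ a x b y≐y' i = +-congˡ (*-congˡ (y≐y' i))

  Span : V → V → V → Set
  Span x y w = ∃ λ a → ∃ λ b → w ≐ lc a x b y

  Independent : V → V → Set
  Independent x y = ∀ a b → IsZero (lc a x b y) → (a ≈ 0#) × (b ≈ 0#)

  independent⇒≉0 : ∀ {x y} → Independent x y → ¬ IsZero x
  independent⇒≉0 ind x≈0 = 1≉0 (proj₁ (ind 1# 0# λ i →
    trans (+-cong (*-congˡ (x≈0 i)) (zeroˡ _)) (trans (+-congʳ (zeroʳ _)) (+-identityʳ _))))

  independent-resp-≐ : ∀ {u u' v v'} → u ≐ u' → v ≐ v' → Independent u v → Independent u' v'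
  independent-resp-≐ u≐u' v≐v' ind a b z = ind a b (λ i → trans (+-cong (*-congˡ (u≐u' i)) (*-congˡ (v≐v' i))) (z i))

  span-fst : ∀ x y → Span x y x
  span-fst x y = 1# , 0# , λ i → sym (trans (+-cong (*-identityˡ _) (zeroˡ _)) (+-identityʳ _))

  span-snd : ∀ x y → Span x y y
  span-snd x y = 0# , 1# , λ i → sym (trans (+-cong (zeroˡ _) (*-identityˡ _)) (+-identityˡ _))

  span-resp-≐ : ∀ {x y w w'} → w ≐ w' → Span x y w → Span x y w'
  span-resp-≐ w≐w' (a , b , w≐) = a , b , ≐-trans (≐-sym w≐w') w≐

  span-* : ∀ {x y w} c → Span x y w → Span x y (λ i → c * w i)
  span-* {x} {y} c (a , b , w≐) = c * a , c * b , λ i → trans (*-congˡ (w≐ i))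
    (solve 5 (λ c a b x y → c :* (a :* x :+ b :* y) := c :* a :* x :+ c :* b :* y) refl c a b (x i) (y i))

  span-proportional : ∀ {x y w w'} c → (∀ i → w i ≈ c * w' i) → Span x y w' → Span x y w
  span-proportional c w≈cw' s = span-resp-≐ (≐-sym w≈cw') (span-* c s)

  span-trans : ∀ {x y z u v} → Span u v z → Span x y u → Span x y v → Span x y z
  span-trans {x} {y} {z} {u} {v} (a , b , z≐) (c , d , u≐) (c' , d' , v≐) =
    a * c + b * c' , a * d + b * d' , λ i → begin
      z i                                                   ≈⟨ z≐ i ⟩
      a * u i + b * v i                                     ≈⟨ +-cong (*-congˡ (u≐ i)) (*-congˡ (v≐ i)) ⟩
      a * (c * x i + d * y i) + b * (c' * x i + d' * y i)   ≈⟨ solve 8 (λ a b c d c' d' x y →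
          a :* (c :* x :+ d :* y) :+ b :* (c' :* x :+ d' :* y)
          := (a :* c :+ b :* c') :* x :+ (a :* d :+ b :* d') :* y) refl a b c d c' d' (x i) (y i) ⟩
      (a * c + b * c') * x i + (a * d + b * d') * y i       ∎

  -- Invert the 2 × 2 matrix of coefficients; if its determinant vanishes, u and v are dependent.
  span-exchange : ∀ {x y u v} → Independent u v → Span x y u → Span x y v → Span u v x × Span u v y
  span-exchange {x} {y} {u} {v} ind (a , b , u≐) (c , d , v≐) with (a * d + - (b * c)) ≟ 0#
  ... | yes det≈0 = ⊥-elim (independent⇒≉0 ind u≈0)
    where
    combination≈det* : ∀ α β γ δ → (∀ i → α * u i + β * v i ≈ (a * d + - (b * c)) * (γ * x i + δ * y i)) →
      IsZero (lc α u β v)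
    combination≈det* α β γ δ eq i = trans (eq i) (trans (*-congʳ det≈0) (zeroˡ _))
    vanish₁ : IsZero (lc d u (- b) v)
    vanish₁ = combination≈det* d (- b) 1# 0# λ i → begin
      d * u i + - b * v i                                     ≈⟨ +-cong (*-congˡ (u≐ i)) (*-congˡ (v≐ i)) ⟩
      d * (a * x i + b * y i) + - b * (c * x i + d * y i)     ≈⟨ solve 6 (λ a b c d x y →
          d :* (a :* x :+ b :* y) :+ :- b :* (c :* x :+ d :* y)
          := (a :* d :+ :- (b :* c)) :* (con (+ 1) :* x :+ con (+ 0) :* y)) refl a b c d (x i) (y i) ⟩
      (a * d + - (b * c)) * (1# * x i + 0# * y i)             ∎
    vanish₂ : IsZero (lc (- c) u a v)
    vanish₂ = combination≈det* (- c) a 0# 1# λ i → begin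
      - c * u i + a * v i                                     ≈⟨ +-cong (*-congˡ (u≐ i)) (*-congˡ (v≐ i)) ⟩
      - c * (a * x i + b * y i) + a * (c * x i + d * y i)     ≈⟨ solve 6 (λ a b c d x y →
          :- c :* (a :* x :+ b :* y) :+ a :* (c :* x :+ d :* y)
          := (a :* d :+ :- (b :* c)) :* (con (+ 0) :* x :+ con (+ 1) :* y)) refl a b c d (x i) (y i) ⟩
      (a * d + - (b * c)) * (0# * x i + 1# * y i)             ∎
    a≈0 : a ≈ 0#
    a≈0 = proj₂ (ind (- c) a vanish₂)
    b≈0 : b ≈ 0#
    b≈0 = trans (sym (-‿involutive b)) (trans (-‿cong (proj₂ (ind d (- b) vanish₁))) -0#≈0#)
    u≈0 : IsZero u
    u≈0 i = trans (u≐ i) (trans (+-cong (trans (*-congʳ a≈0) (zeroˡ _)) (trans (*-congʳ b≈0) (zeroˡ _))) (+-identityʳ _))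
  ... | no det≉0 = (d * t , - b * t , λ i → sym (x≈ i)) , (- c * t , a * t , λ i → sym (y≈ i))
    where
    t = (a * d + - (b * c)) ⁻¹
    t*det≈1 : t * (a * d + - (b * c)) ≈ 1#
    t*det≈1 = x⁻¹*x≈1 det≉0
    x≈ : ∀ i → d * t * u i + - b * t * v i ≈ x i
    x≈ i = begin
      d * t * u i + - b * t * v i                                 ≈⟨ +-cong (*-congˡ (u≐ i)) (*-congˡ (v≐ i)) ⟩
      d * t * (a * x i + b * y i) + - b * t * (c * x i + d * y i) ≈⟨ solve 7 (λ a b c d t x y →
          d :* t :* (a :* x :+ b :* y) :+ :- b :* t :* (c :* x :+ d :* y)
          := t :* (a :* d :+ :- (b :* c)) :* x) refl a b c d t (x i) (y i) ⟩
      t * (a * d + - (b * c)) * x i                               ≈⟨ trans (*-congʳ t*det≈1) (*-identityˡ _) ⟩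
      x i                                                         ∎
    y≈ : ∀ i → - c * t * u i + a * t * v i ≈ y i
    y≈ i = begin
      - c * t * u i + a * t * v i                                   ≈⟨ +-cong (*-congˡ (u≐ i)) (*-congˡ (v≐ i)) ⟩
      - c * t * (a * x i + b * y i) + a * t * (c * x i + d * y i)   ≈⟨ solve 7 (λ a b c d t x y →
          :- c :* t :* (a :* x :+ b :* y) :+ a :* t :* (c :* x :+ d :* y)
          := t :* (a :* d :+ :- (b :* c)) :* y) refl a b c d t (x i) (y i) ⟩
      t * (a * d + - (b * c)) * y i                                 ≈⟨ trans (*-congʳ t*det≈1) (*-identityˡ _) ⟩
      y i                                                           ∎

  ≈ₗ-by-independent : ∀ {u v} (h h' : Line) → Independent u v →
    InSpan u h → InSpan v h → InSpan u h' → InSpan v h' → h ≈ₗ h'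
  ≈ₗ-by-independent h h' ind u∈h v∈h u∈h' v∈h' =
    let (x∈uv , y∈uv) = span-exchange ind u∈h v∈h
        (x'∈uv , y'∈uv) = span-exchange ind u∈h' v∈h'
    in (span-trans x∈uv u∈h' v∈h' , span-trans y∈uv u∈h' v∈h')
     , (span-trans x'∈uv u∈h v∈h , span-trans y'∈uv u∈h v∈h)

  NonZero₂ : Carrier → Carrier → Set
  NonZero₂ a b = ¬ ((a ≈ 0#) × (b ≈ 0#))

  det : Carrier → Carrier → Carrier → Carrier → Carrier
  det a₀ a₁ b₀ b₁ = a₀ * b₁ + - (a₁ * b₀)

  Proportional₂ : Carrier → Carrier → Carrier → Carrier → Set
  Proportional₂ b₀ b₁ a₀ a₁ = ∃ λ μ → (b₀ ≈ μ * a₀) × (b₁ ≈ μ * a₁)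

  x*0-y*0≈0 : ∀ x y → x * 0# + - (y * 0#) ≈ 0#
  x*0-y*0≈0 = solve 2 (λ x y → x :* con (+ 0) :+ :- (y :* con (+ 0)) := con (+ 0)) refl

  ⊥-common⇒det≈0 : ∀ {f₀ f₁} a₀ a₁ b₀ b₁ → NonZero₂ f₀ f₁ →
    f₀ * a₀ + f₁ * a₁ ≈ 0# → f₀ * b₀ + f₁ * b₁ ≈ 0# → det a₀ a₁ b₀ b₁ ≈ 0#
  ⊥-common⇒det≈0 {f₀} {f₁} a₀ a₁ b₀ b₁ f≉0 f⊥a f⊥b with f₀ ≟ 0#
  ... | no f₀≉0 = x*y≈0⇒y≈0 f₀≉0 (begin
    f₀ * (a₀ * b₁ + - (a₁ * b₀))                              ≈⟨ solve 6 (λ f₀ f₁ a₀ a₁ b₀ b₁ →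
        f₀ :* (a₀ :* b₁ :+ :- (a₁ :* b₀))
        := b₁ :* (f₀ :* a₀ :+ f₁ :* a₁) :+ :- (a₁ :* (f₀ :* b₀ :+ f₁ :* b₁))) refl f₀ f₁ a₀ a₁ b₀ b₁ ⟩
    b₁ * (f₀ * a₀ + f₁ * a₁) + - (a₁ * (f₀ * b₀ + f₁ * b₁))   ≈⟨ +-cong (*-congˡ f⊥a) (-‿cong (*-congˡ f⊥b)) ⟩
    b₁ * 0# + - (a₁ * 0#)                                     ≈⟨ x*0-y*0≈0 b₁ a₁ ⟩
    0#                                                        ∎)
  ... | yes f₀≈0 = x*y≈0⇒y≈0 (λ f₁≈0 → f≉0 (f₀≈0 , f₁≈0)) (begin
    f₁ * (a₀ * b₁ + - (a₁ * b₀))                              ≈⟨ solve 6 (λ f₀ f₁ a₀ a₁ b₀ b₁ →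
        f₁ :* (a₀ :* b₁ :+ :- (a₁ :* b₀))
        := a₀ :* (f₀ :* b₀ :+ f₁ :* b₁) :+ :- (b₀ :* (f₀ :* a₀ :+ f₁ :* a₁))) refl f₀ f₁ a₀ a₁ b₀ b₁ ⟩
    a₀ * (f₀ * b₀ + f₁ * b₁) + - (b₀ * (f₀ * a₀ + f₁ * a₁))   ≈⟨ +-cong (*-congˡ f⊥b) (-‿cong (*-congˡ f⊥a)) ⟩
    a₀ * 0# + - (b₀ * 0#)                                     ≈⟨ x*0-y*0≈0 a₀ b₀ ⟩
    0#                                                        ∎)

  det≈0⇒proportional : ∀ a₀ a₁ b₀ b₁ → NonZero₂ a₀ a₁ → det a₀ a₁ b₀ b₁ ≈ 0# →
    Proportional₂ b₀ b₁ a₀ a₁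
  det≈0⇒proportional a₀ a₁ b₀ b₁ a≉0 det≈0 with a₀ ≟ 0#
  ... | no a₀≉0 = b₀ * a₀ ⁻¹ , b₀≈ , b₁≈
    where
    b₀≈ : b₀ ≈ b₀ * a₀ ⁻¹ * a₀
    b₀≈ = sym (trans (*-assoc _ _ _) (trans (*-congˡ (x⁻¹*x≈1 a₀≉0)) (*-identityʳ _)))
    b₁≈ : b₁ ≈ b₀ * a₀ ⁻¹ * a₁
    b₁≈ = *-cancelˡ a₀≉0 (begin
      a₀ * b₁                   ≈⟨ x-y≈0⇒x≈y det≈0 ⟩
      a₁ * b₀                   ≈⟨ *-comm a₁ b₀ ⟩
      b₀ * a₁                   ≈⟨ *-congʳ (trans (sym (*-identityʳ b₀)) (*-congˡ (sym (x*x⁻¹≈1 a₀≉0)))) ⟩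
      b₀ * (a₀ * a₀ ⁻¹) * a₁    ≈⟨ solve 4 (λ b a t c → b :* (a :* t) :* c := a :* (b :* t :* c))
                                     refl b₀ a₀ (a₀ ⁻¹) a₁ ⟩
      a₀ * (b₀ * a₀ ⁻¹ * a₁)    ∎)
  ... | yes a₀≈0 = b₁ * a₁ ⁻¹ , b₀≈ , b₁≈
    where
    a₁≉0 : a₁ ≉ 0#
    a₁≉0 a₁≈0 = a≉0 (a₀≈0 , a₁≈0)
    b₁≈ : b₁ ≈ b₁ * a₁ ⁻¹ * a₁
    b₁≈ = sym (trans (*-assoc _ _ _) (trans (*-congˡ (x⁻¹*x≈1 a₁≉0)) (*-identityʳ _)))
    a₁*b₀≈0 : a₁ * b₀ ≈ 0#
    a₁*b₀≈0 = trans (sym (x-y≈0⇒x≈y det≈0)) (trans (*-congʳ a₀≈0) (zeroˡ _))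
    b₀≈ : b₀ ≈ b₁ * a₁ ⁻¹ * a₀
    b₀≈ = trans (x*y≈0⇒y≈0 a₁≉0 a₁*b₀≈0) (sym (trans (*-congˡ a₀≈0) (zeroʳ _)))

  ⊥-common⇒proportional : ∀ {f₀ f₁} a₀ a₁ b₀ b₁ → NonZero₂ f₀ f₁ → NonZero₂ a₀ a₁ →
    f₀ * a₀ + f₁ * a₁ ≈ 0# → f₀ * b₀ + f₁ * b₁ ≈ 0# → Proportional₂ b₀ b₁ a₀ a₁
  ⊥-common⇒proportional a₀ a₁ b₀ b₁ f≉0 a≉0 f⊥a f⊥b =
    det≈0⇒proportional a₀ a₁ b₀ b₁ a≉0 (⊥-common⇒det≈0 a₀ a₁ b₀ b₁ f≉0 f⊥a f⊥b)

  proportional₂⇒factor≉0 : ∀ {a b a' b' l} → NonZero₂ a b → a ≈ l * a' → b ≈ l * b' → l ≉ 0#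
  proportional₂⇒factor≉0 ab≉0 a≈ b≈ l≈0 =
    ab≉0 (trans a≈ (trans (*-congʳ l≈0) (zeroˡ _)) , trans b≈ (trans (*-congʳ l≈0) (zeroˡ _)))

  -- The normalising denominator of the codes below.
  pivot : Carrier → Carrier → Carrier
  pivot a b with a ≟ 0#
  ... | yes _ = b
  ... | no _ = a

  pivot≉0 : ∀ {a b} → NonZero₂ a b → pivot a b ≉ 0#
  pivot≉0 {a} {b} ab≉0 with a ≟ 0#
  ... | yes a≈0 = λ b≈0 → ab≉0 (a≈0 , b≈0)
  ... | no a≉0 = a≉0

  pivot-* : ∀ {a b a' b' l} → NonZero₂ a b → NonZero₂ a' b' → a ≈ l * a' → b ≈ l * b' →
    pivot a b ≈ l * pivot a' b'
  pivot-* {a} {b} {a'} {b'} {l} ab≉0 _ a≈ b≈ with a ≟ 0# | a' ≟ 0#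
  ... | yes _ | yes _ = b≈
  ... | no _ | no _ = a≈
  ... | yes a≈0 | no a'≉0 =
    ⊥-elim (proportional₂⇒factor≉0 ab≉0 a≈ b≈ (x*y≈0⇒x≈0 a'≉0 (trans (sym a≈) a≈0)))
  ... | no a≉0 | yes a'≈0 = ⊥-elim (a≉0 (trans a≈ (trans (*-congˡ a'≈0) (zeroʳ _))))

  pcode : Carrier → Carrier → Fin (suc q)
  pcode a b with a ≟ 0#
  ... | yes _ = Fin.zero
  ... | no _ = Fin.suc (index (b * a ⁻¹))

  pcode-injective : ∀ {a b a' b'} → NonZero₂ a b → NonZero₂ a' b' → pcode a b ≡ pcode a' b' →
    Proportional₂ a b a' b'
  pcode-injective {a} {b} {a'} {b'} ab≉0 a'b'≉0 same with a ≟ 0# | a' ≟ 0#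
  ... | yes a≈0 | yes a'≈0 = b * b' ⁻¹
    , trans a≈0 (sym (trans (*-congˡ a'≈0) (zeroʳ _)))
    , sym (trans (*-assoc _ _ _) (trans (*-congˡ (x⁻¹*x≈1 (λ b'≈0 → a'b'≉0 (a'≈0 , b'≈0)))) (*-identityʳ _)))
  ... | no a≉0 | no a'≉0 = a * a' ⁻¹
    , sym (trans (*-assoc _ _ _) (trans (*-congˡ (x⁻¹*x≈1 a'≉0)) (*-identityʳ _)))
    , (begin
      b                   ≈⟨ sym (trans (*-congˡ (x*x⁻¹≈1 a≉0)) (*-identityʳ b)) ⟩
      b * (a * a ⁻¹)      ≈⟨ solve 3 (λ b a t → b :* (a :* t) := a :* (b :* t)) refl b a (a ⁻¹) ⟩
      a * (b * a ⁻¹)      ≈⟨ *-congˡ (index-injective (FinP.suc-injective same)) ⟩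
      a * (b' * a' ⁻¹)    ≈⟨ solve 3 (λ a b t → a :* (b :* t) := a :* t :* b) refl a b' (a' ⁻¹) ⟩
      a * a' ⁻¹ * b'      ∎)

  proportional₂-trans : ∀ {a b a' b' a'' b''} → Proportional₂ a b a' b' → Proportional₂ a' b' a'' b'' →
    Proportional₂ a b a'' b''
  proportional₂-trans (c , a≈ , b≈) (d , a'≈ , b'≈) =
    c * d , trans a≈ (trans (*-congˡ a'≈) (sym (*-assoc _ _ _))) , trans b≈ (trans (*-congˡ b'≈) (sym (*-assoc _ _ _)))

  proportional₂-sym : ∀ {a b a' b'} → NonZero₂ a b → Proportional₂ a b a' b' → Proportional₂ a' b' a b
  proportional₂-sym ab≉0 (c , a≈ , b≈) = c ⁻¹ , a'≈ a≈ , a'≈ b≈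
    where
    c≉0 = proportional₂⇒factor≉0 ab≉0 a≈ b≈
    a'≈ : ∀ {x x'} → x ≈ c * x' → x' ≈ c ⁻¹ * x
    a'≈ {x} {x'} x≈ = sym (trans (*-congˡ x≈) (x⁻¹*[x*y]≈y x' c≉0))

  ⊥₂-comm : ∀ {a b x y} → a * x + b * y ≈ 0# → x * a + y * b ≈ 0#
  ⊥₂-comm a⊥x = trans (+-cong (*-comm _ _) (*-comm _ _)) a⊥x

  ⊥₂-* : ∀ {a b a' b' x y} c → a ≈ c * a' → b ≈ c * b' → a' * x + b' * y ≈ 0# → a * x + b * y ≈ 0#
  ⊥₂-* {a} {b} {a'} {b'} {x} {y} c a≈ b≈ a'⊥x = begin
    a * x + b * y               ≈⟨ +-cong (*-congʳ a≈) (*-congʳ b≈) ⟩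
    c * a' * x + c * b' * y     ≈⟨ solve 5 (λ c a b x y → c :* a :* x :+ c :* b :* y := c :* (a :* x :+ b :* y)) refl c a' b' x y ⟩
    c * (a' * x + b' * y)       ≈⟨ *-congˡ a'⊥x ⟩
    c * 0#                      ≈⟨ zeroʳ _ ⟩
    0#                          ∎

  affine-code : Carrier → Carrier → Carrier → Carrier → Fin (q ℕ.* q)
  affine-code x y s t = Fin.combine (index (x * pivot s t ⁻¹)) (index (y * pivot s t ⁻¹))

  affine-code-injective : ∀ {x y s t x' y' s' t' l} → NonZero₂ s t → NonZero₂ s' t' → s ≈ l * s' → t ≈ l * t' →
    affine-code x y s t ≡ affine-code x' y' s' t' → (x ≈ l * x') × (y ≈ l * y')
  affine-code-injective st≉0 s't'≉0 s≈ t≈ same =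
      x/s≈x'/s'⇒x≈l*x' (pivot≉0 st≉0) (pivot≉0 s't'≉0) pivots≈ (index-injective (proj₁ same-parts))
    , x/s≈x'/s'⇒x≈l*x' (pivot≉0 st≉0) (pivot≉0 s't'≉0) pivots≈ (index-injective (proj₂ same-parts))
    where
    same-parts = FinP.combine-injective _ _ _ _ same
    pivots≈ = pivot-* st≉0 s't'≉0 s≈ t≈

  i₀ i₁ i₂ i₃ : Fin 4
  i₀ = Fin.zero
  i₁ = Fin.suc Fin.zero
  i₂ = Fin.suc (Fin.suc Fin.zero)
  i₃ = Fin.suc (Fin.suc (Fin.suc Fin.zero))

  e : Fin 4 → V
  e j i with i FinP.≟ j
  ... | yes _ = 1#
  ... | no _ = 0#

  e-diag : ∀ j → e j j ≈ 1#
  e-diag j with j FinP.≟ j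
  ... | yes _ = refl
  ... | no j≢j = ⊥-elim (j≢j ≡.refl)

  e-off : ∀ j i → i ≢ j → e j i ≈ 0#
  e-off j i i≢j with i FinP.≟ j
  ... | yes i≡j = ⊥-elim (i≢j i≡j)
  ... | no _ = refl

  ≐-basis-expansion : ∀ z → z ≐ lc (z i₀) (e i₀) 1# (lc (z i₁) (e i₁) 1# (lc (z i₂) (e i₂) (z i₃) (e i₃)))
  ≐-basis-expansion z Fin.zero = solve 4 (λ a b c d →
    a := a :* con (+ 1) :+ con (+ 1) :* (b :* con (+ 0) :+ con (+ 1) :* (c :* con (+ 0) :+ d :* con (+ 0))))
    refl (z i₀) (z i₁) (z i₂) (z i₃)
  ≐-basis-expansion z (Fin.suc Fin.zero) = solve 4 (λ a b c d →
    b := a :* con (+ 0) :+ con (+ 1) :* (b :* con (+ 1) :+ con (+ 1) :* (c :* con (+ 0) :+ d :* con (+ 0))))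
    refl (z i₀) (z i₁) (z i₂) (z i₃)
  ≐-basis-expansion z (Fin.suc (Fin.suc Fin.zero)) = solve 4 (λ a b c d →
    c := a :* con (+ 0) :+ con (+ 1) :* (b :* con (+ 0) :+ con (+ 1) :* (c :* con (+ 1) :+ d :* con (+ 0))))
    refl (z i₀) (z i₁) (z i₂) (z i₃)
  ≐-basis-expansion z (Fin.suc (Fin.suc (Fin.suc Fin.zero))) = solve 4 (λ a b c d →
    d := a :* con (+ 0) :+ con (+ 1) :* (b :* con (+ 0) :+ con (+ 1) :* (c :* con (+ 0) :+ d :* con (+ 1))))
    refl (z i₀) (z i₁) (z i₂) (z i₃)

  dot-congʳ : ∀ f {x y} → x ≐ y → dot f x ≈ dot f y
  dot-congʳ f x≐y =
    +-cong (*-congˡ (x≐y i₀)) (+-cong (*-congˡ (x≐y i₁)) (+-cong (*-congˡ (x≐y i₂)) (*-congˡ (x≐y i₃))))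

  dot-congˡ : ∀ {f g} x → f ≐ g → dot f x ≈ dot g x
  dot-congˡ x f≐g =
    +-cong (*-congʳ (f≐g i₀)) (+-cong (*-congʳ (f≐g i₁)) (+-cong (*-congʳ (f≐g i₂)) (*-congʳ (f≐g i₃))))

  dot-*ˡ : ∀ c f x → dot (λ j → c * f j) x ≈ c * dot f x
  dot-*ˡ c f x = solve 9 (λ c f₀ f₁ f₂ f₃ x₀ x₁ x₂ x₃ →
    c :* f₀ :* x₀ :+ (c :* f₁ :* x₁ :+ (c :* f₂ :* x₂ :+ c :* f₃ :* x₃))
    := c :* (f₀ :* x₀ :+ (f₁ :* x₁ :+ (f₂ :* x₂ :+ f₃ :* x₃))))
    refl c (f i₀) (f i₁) (f i₂) (f i₃) (x i₀) (x i₁) (x i₂) (x i₃)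

  dot-*ʳ : ∀ f c x → dot f (λ i → c * x i) ≈ c * dot f x
  dot-*ʳ f c x = solve 9 (λ c f₀ f₁ f₂ f₃ x₀ x₁ x₂ x₃ →
    f₀ :* (c :* x₀) :+ (f₁ :* (c :* x₁) :+ (f₂ :* (c :* x₂) :+ f₃ :* (c :* x₃)))
    := c :* (f₀ :* x₀ :+ (f₁ :* x₁ :+ (f₂ :* x₂ :+ f₃ :* x₃))))
    refl c (f i₀) (f i₁) (f i₂) (f i₃) (x i₀) (x i₁) (x i₂) (x i₃)

  dot-zeroˡ : ∀ {f} x → IsZero f → dot f x ≈ 0#
  dot-zeroˡ x f≈0 = trans (dot-congˡ x f≈0) (solve 4 (λ x₀ x₁ x₂ x₃ →
    con (+ 0) :* x₀ :+ (con (+ 0) :* x₁ :+ (con (+ 0) :* x₂ :+ con (+ 0) :* x₃)) := con (+ 0))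
    refl (x i₀) (x i₁) (x i₂) (x i₃))

  dot-lc : ∀ f a x b y → dot f (lc a x b y) ≈ a * dot f x + b * dot f y
  dot-lc f a x b y = solve 14 (λ f₀ f₁ f₂ f₃ a x₀ x₁ x₂ x₃ b y₀ y₁ y₂ y₃ →
    f₀ :* (a :* x₀ :+ b :* y₀) :+ (f₁ :* (a :* x₁ :+ b :* y₁)
      :+ (f₂ :* (a :* x₂ :+ b :* y₂) :+ f₃ :* (a :* x₃ :+ b :* y₃)))
    := a :* (f₀ :* x₀ :+ (f₁ :* x₁ :+ (f₂ :* x₂ :+ f₃ :* x₃)))
      :+ b :* (f₀ :* y₀ :+ (f₁ :* y₁ :+ (f₂ :* y₂ :+ f₃ :* y₃))))
    refl (f i₀) (f i₁) (f i₂) (f i₃) a (x i₀) (x i₁) (x i₂) (x i₃) b (y i₀) (y i₁) (y i₂) (y i₃)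

  dot-e : ∀ f i → dot f (e i) ≈ f i
  dot-e f Fin.zero = solve 4 (λ a b c d →
    a :* con (+ 1) :+ (b :* con (+ 0) :+ (c :* con (+ 0) :+ d :* con (+ 0))) := a) refl (f i₀) (f i₁) (f i₂) (f i₃)
  dot-e f (Fin.suc Fin.zero) = solve 4 (λ a b c d →
    a :* con (+ 0) :+ (b :* con (+ 1) :+ (c :* con (+ 0) :+ d :* con (+ 0))) := b) refl (f i₀) (f i₁) (f i₂) (f i₃)
  dot-e f (Fin.suc (Fin.suc Fin.zero)) = solve 4 (λ a b c d →
    a :* con (+ 0) :+ (b :* con (+ 0) :+ (c :* con (+ 1) :+ d :* con (+ 0))) := c) refl (f i₀) (f i₁) (f i₂) (f i₃)
  dot-e f (Fin.suc (Fin.suc (Fin.suc Fin.zero))) = solve 4 (λ a b c d →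
    a :* con (+ 0) :+ (b :* con (+ 0) :+ (c :* con (+ 0) :+ d :* con (+ 1))) := d) refl (f i₀) (f i₁) (f i₂) (f i₃)

  Congruent : (V → V) → Set
  Congruent L = ∀ {x y} → x ≐ y → L x ≐ L y

  Linear : (V → V) → Set
  Linear L = ∀ a x b y → L (lc a x b y) ≐ lc a (L x) b (L y)

  module LinearMap (L : V → V) (L-cong : Congruent L) (L-linear : Linear L) where

    L-0v : L 0v ≐ 0v
    L-0v = ≐-trans (L-cong 0v≐) (≐-trans (L-linear 0# 0v 0# 0v) (≐-sym 0v≐))
      where
      0v≐ : ∀ {y} → 0v ≐ lc 0# y 0# y
      0v≐ i = sym (trans (+-cong (zeroˡ _) (zeroˡ _)) (+-identityʳ _))

    L-* : ∀ c x → L (λ i → c * x i) ≐ (λ i → c * L x i)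
    L-* c x = ≐-trans (L-cong cx≐) (≐-trans (L-linear c x 0# x) (≐-sym cx≐))
      where
      cx≐ : ∀ {y} → (λ i → c * y i) ≐ lc c y 0# y
      cx≐ i = sym (trans (+-congˡ (zeroˡ _)) (+-identityʳ _))

    transpose-form : V → V
    transpose-form f j = dot f (L (e j))

    dot-transpose : ∀ f z → dot f (L z) ≈ dot (transpose-form f) z
    dot-transpose f z = begin
      dot f (L z)
        ≈⟨ dot-congʳ f (≐-trans (L-cong (≐-basis-expansion z)) (≐-trans (L-linear _ _ _ _)
             (lc-congʳ _ _ _ (≐-trans (L-linear _ _ _ _) (lc-congʳ _ _ _ (L-linear _ _ _ _)))))) ⟩
      dot f (lc (z i₀) (w i₀) 1# (lc (z i₁) (w i₁) 1# (lc (z i₂) (w i₂) (z i₃) (w i₃))))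
        ≈⟨ trans (dot-lc f (z i₀) (w i₀) 1# w₁₂₃) (+-congˡ (*-congˡ (trans (dot-lc f (z i₁) (w i₁) 1# w₂₃)
             (+-congˡ (*-congˡ (dot-lc f (z i₂) (w i₂) (z i₃) (w i₃))))))) ⟩
      z i₀ * d i₀ + 1# * (z i₁ * d i₁ + 1# * (z i₂ * d i₂ + z i₃ * d i₃))
        ≈⟨ solve 8 (λ z₀ z₁ z₂ z₃ d₀ d₁ d₂ d₃ →
             z₀ :* d₀ :+ con (+ 1) :* (z₁ :* d₁ :+ con (+ 1) :* (z₂ :* d₂ :+ z₃ :* d₃))
             := d₀ :* z₀ :+ (d₁ :* z₁ :+ (d₂ :* z₂ :+ d₃ :* z₃)))
             refl (z i₀) (z i₁) (z i₂) (z i₃) (d i₀) (d i₁) (d i₂) (d i₃) ⟩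
      dot (transpose-form f) z ∎
      where
      w : Fin 4 → V
      w j = L (e j)
      w₂₃ w₁₂₃ : V
      w₂₃ = lc (z i₂) (w i₂) (z i₃) (w i₃)
      w₁₂₃ = lc (z i₁) (w i₁) 1# w₂₃
      d : V
      d = transpose-form f

  -- Linear automorphisms and their action on flags

  record Automorphism : Set where
    field
      to from : V → V
      to-cong : Congruent to
      from-cong : Congruent from
      to-linear : Linear to
      from-linear : Linear from
      from∘to : ∀ x → from (to x) ≐ x
      to∘from : ∀ x → to (from x) ≐ x

  infixr 9 _⨾_
  _⨾_ : Automorphism → Automorphism → Automorphism
  A ⨾ B = record
    { to = λ x → B.to (A.to x) ; from = λ x → A.from (B.from x)
    ; to-cong = λ x≐y → B.to-cong (A.to-cong x≐y) ; from-cong = λ x≐y → A.from-cong (B.from-cong x≐y)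
    ; to-linear = λ a x b y → ≐-trans (B.to-cong (A.to-linear a x b y)) (B.to-linear _ _ _ _)
    ; from-linear = λ a x b y → ≐-trans (A.from-cong (B.from-linear a x b y)) (A.from-linear _ _ _ _)
    ; from∘to = λ x → ≐-trans (A.from-cong (B.from∘to (A.to x))) (A.from∘to x)
    ; to∘from = λ x → ≐-trans (B.to-cong (A.to∘from (B.from x))) (B.to∘from x) }
    where
    module A = Automorphism A
    module B = Automorphism B

  -- An automorphism acts on points and lines through vectors, and on planes through forms by
  -- f ↦ f ∘ from, so that incidence is preserved.
  module Action (A : Automorphism) where
    open Automorphism A
    open LinearMap to to-cong to-linear using (L-0v; L-*)
    open LinearMap from from-cong from-linear using (transpose-form; dot-transpose)

    form-to : V → V
    form-to = transpose-form

    dot-form-to : ∀ f w → dot (form-to f) (to w) ≈ dot f w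
    dot-form-to f w = trans (sym (dot-transpose f (to w))) (dot-congʳ f (from∘to w))

    to-injective : ∀ {x y} → to x ≐ to y → x ≐ y
    to-injective {x} {y} tx≐ty = ≐-trans (≐-sym (from∘to x)) (≐-trans (from-cong tx≐ty) (from∘to y))

    IsZero-to⁻ : ∀ {x} → IsZero (to x) → IsZero x
    IsZero-to⁻ tx≈0 = to-injective (≐-trans tx≈0 (≐-sym L-0v))

    coordinate-via-form-to : ∀ f i → f i ≈ dot (form-to f) (to (e i))
    coordinate-via-form-to f i = trans (sym (dot-e f i)) (sym (dot-form-to f (e i)))

    IsZero-form-to⁻ : ∀ {f} → IsZero (form-to f) → IsZero f
    IsZero-form-to⁻ {f} f'≈0 i = trans (coordinate-via-form-to f i) (dot-zeroˡ (to (e i)) f'≈0)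

    span-to : ∀ {x y w} → Span x y w → Span (to x) (to y) (to w)
    span-to {x} {y} (a , b , w≐) = a , b , ≐-trans (to-cong w≐) (to-linear a x b y)

    span-to⁻ : ∀ {x y w} → Span (to x) (to y) (to w) → Span x y w
    span-to⁻ {x} {y} {w} (a , b , tw≐) = a , b ,
      ≐-trans (≐-sym (from∘to w)) (≐-trans (from-cong tw≐) (≐-trans (from-linear a (to x) b (to y))
        (λ i → +-cong (*-congˡ (from∘to x i)) (*-congˡ (from∘to y i)))))

    point-to : Point → Point
    point-to (point v v≉0) = point (to v) (λ tv≈0 → v≉0 (IsZero-to⁻ tv≈0))

    plane-to : Plane → Plane
    plane-to (plane f f≉0) = plane (form-to f) (λ f'≈0 → f≉0 (IsZero-form-to⁻ f'≈0))

    line-to : Line → Line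
    line-to (line u v ind) = line (to u) (to v)
      (λ a b z → ind a b (IsZero-to⁻ (λ i → trans (to-linear a u b v i) (z i))))

    chamber-to : Chamber → Chamber
    chamber-to (chamber P h π P∈h h⊆π) = chamber (point-to P) (line-to h) (plane-to π) (span-to P∈h)
      ( trans (dot-form-to (Plane.form π) (Line.u h)) (proj₁ h⊆π)
      , trans (dot-form-to (Plane.form π) (Line.v h)) (proj₂ h⊆π))

    ≈ₚ-to⁻ : ∀ P P' → point-to P ≈ₚ point-to P' → P ≈ₚ P'
    ≈ₚ-to⁻ (point v _) (point v' _) (c , tv≐) = c , to-injective (≐-trans tv≐ (≐-sym (L-* c v')))

    ≈π-to⁻ : ∀ π π' → plane-to π ≈π plane-to π' → π ≈π π'
    ≈π-to⁻ (plane f _) (plane f' _) (c , f≐) = c , λ i → begin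
      f i                                           ≈⟨ coordinate-via-form-to f i ⟩
      dot (form-to f) (to (e i))                    ≈⟨ dot-congˡ (to (e i)) f≐ ⟩
      dot (λ j → c * form-to f' j) (to (e i))       ≈⟨ dot-*ˡ c (form-to f') (to (e i)) ⟩
      c * dot (form-to f') (to (e i))               ≈⟨ *-congˡ (coordinate-via-form-to f' i) ⟨
      c * f' i                                      ∎

    ≈ₗ-to⁻ : ∀ h h' → line-to h ≈ₗ line-to h' → h ≈ₗ h'
    ≈ₗ-to⁻ (line _ _ _) (line _ _ _) ((u∈ , v∈) , (u'∈ , v'∈)) =
      (span-to⁻ u∈ , span-to⁻ v∈) , (span-to⁻ u'∈ , span-to⁻ v'∈)

    ≈ᶜ-to⁻ : ∀ C D → chamber-to C ≈ᶜ chamber-to D → C ≈ᶜ D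
    ≈ᶜ-to⁻ (chamber P h π _ _) (chamber P' h' π' _ _) (P≈ , h≈ , π≈) =
      ≈ₚ-to⁻ P P' P≈ , ≈ₗ-to⁻ h h' h≈ , ≈π-to⁻ π π' π≈

    opposite-to⁻ : ∀ C D → Opposite (chamber-to C) (chamber-to D) → Opposite C D
    opposite-to⁻ (chamber P h π _ _) (chamber P' h' π' _ _) (P∉π' , disjoint , P'∉π) =
        (λ P∈π' → P∉π' (trans (dot-form-to (Plane.form π') (Point.vec P)) P∈π'))
      , (λ w w∈h w∈h' → IsZero-to⁻ (disjoint (to w) (span-to-line h w∈h) (span-to-line h' w∈h')))
      , (λ P'∈π → P'∉π (trans (dot-form-to (Plane.form π) (Point.vec P')) P'∈π))
      where
      span-to-line : ∀ (h : Line) {w} → InSpan w h → InSpan (to w) (line-to h)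
      span-to-line (line _ _ _) w∈h = span-to w∈h

  e-transpose : ∀ i j a k → e a (transpose i j k) ≈ e (transpose j i a) k
  e-transpose i j a k with transpose i j k FinP.≟ a | k FinP.≟ transpose j i a
  ... | yes _ | yes _ = refl
  ... | no _ | no _ = refl
  ... | yes t≡a | no k≢ = ⊥-elim (k≢ (≡.trans (≡.sym (transpose-inverse j i)) (≡.cong (transpose j i) t≡a)))
  ... | no t≢a | yes k≡ = ⊥-elim (t≢a (≡.trans (≡.cong (transpose i j) k≡) (transpose-inverse i j)))

  swap : Fin 4 → Fin 4 → Automorphism
  swap i j = record
    { to = λ w k → w (transpose i j k) ; from = λ w k → w (transpose j i k)
    ; to-cong = λ x≐y k → x≐y _ ; from-cong = λ x≐y k → x≐y _
    ; to-linear = λ _ _ _ _ _ → refl ; from-linear = λ _ _ _ _ _ → refl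
    ; from∘to = λ x k → reflexive (≡.cong x (transpose-inverse i j))
    ; to∘from = λ x k → reflexive (≡.cong x (transpose-inverse j i)) }

  swap-e : ∀ i j a → Automorphism.to (swap i j) (e a) ≐ e (transpose j i a)
  swap-e i j a = e-transpose i j a

  swap-e-fst : ∀ i j → Automorphism.to (swap i j) (e j) ≐ e i
  swap-e-fst i j k = trans (swap-e i j j k) (reflexive (≡.cong (λ t → e t k) (transpose-inverse′ j i)))
    where
    transpose-inverse′ : ∀ (j i : Fin 4) → transpose j i j ≡ i
    transpose-inverse′ j i rewrite dec-true (j FinP.≟ j) ≡.refl = ≡.refl

  swap-e-other : ∀ i j a → a ≢ i → a ≢ j → Automorphism.to (swap i j) (e a) ≐ e a
  swap-e-other i j a a≢i a≢j k = trans (swap-e i j a k) (reflexive (≡.cong (λ t → e t k) transpose-fixes))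
    where
    transpose-fixes : transpose j i a ≡ a
    transpose-fixes rewrite dec-false (a FinP.≟ j) a≢j | dec-false (a FinP.≟ i) a≢i = ≡.refl

  -- The shear-and-scale x ↦ x - (x k / z k) z + (x k / z k) e k, which sends z to e k.
  module Pivot (k : Fin 4) (z : V) (zₖ≉0 : z k ≉ 0#) where
    r : Carrier
    r = z k ⁻¹

    zₖ*r≈1 : z k * r ≈ 1#
    zₖ*r≈1 = x*x⁻¹≈1 zₖ≉0

    to : V → V
    to w i with i FinP.≟ k
    ... | yes _ = w k * r
    ... | no _ = w i + - (w k * r * z i)

    from : V → V
    from w i with i FinP.≟ k
    ... | yes _ = w k * z k
    ... | no _ = w i + w k * z i

    to-at-k : ∀ w → to w k ≈ w k * r
    to-at-k w with k FinP.≟ k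
    ... | yes _ = refl
    ... | no k≢k = ⊥-elim (k≢k ≡.refl)

    from-at-k : ∀ w → from w k ≈ w k * z k
    from-at-k w with k FinP.≟ k
    ... | yes _ = refl
    ... | no k≢k = ⊥-elim (k≢k ≡.refl)

    to-off-k : ∀ w i → i ≢ k → to w i ≈ w i + - (w k * r * z i)
    to-off-k w i i≢k with i FinP.≟ k
    ... | yes i≡k = ⊥-elim (i≢k i≡k)
    ... | no _ = refl

    from-off-k : ∀ w i → i ≢ k → from w i ≈ w i + w k * z i
    from-off-k w i i≢k with i FinP.≟ k
    ... | yes i≡k = ⊥-elim (i≢k i≡k)
    ... | no _ = refl

    automorphism : Automorphism
    automorphism = record
      { to = to ; from = from ; to-cong = to-cong ; from-cong = from-cong
      ; to-linear = to-linear ; from-linear = from-linear ; from∘to = from∘to ; to∘from = to∘from }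
      where
      to-cong : Congruent to
      to-cong x≐y i with i FinP.≟ k
      ... | yes _ = *-congʳ (x≐y k)
      ... | no _ = +-cong (x≐y i) (-‿cong (*-congʳ (*-congʳ (x≐y k))))

      from-cong : Congruent from
      from-cong x≐y i with i FinP.≟ k
      ... | yes _ = *-congʳ (x≐y k)
      ... | no _ = +-cong (x≐y i) (*-congʳ (x≐y k))

      to-linear : Linear to
      to-linear a x b y i with i FinP.≟ k
      ... | yes _ = solve 5 (λ a x b y r → (a :* x :+ b :* y) :* r := a :* (x :* r) :+ b :* (y :* r))
                      refl a (x k) b (y k) r
      ... | no _ = solve 8 (λ a x b y r xᵢ yᵢ zᵢ → (a :* xᵢ :+ b :* yᵢ) :+ :- ((a :* x :+ b :* y) :* r :* zᵢ)
                      := a :* (xᵢ :+ :- (x :* r :* zᵢ)) :+ b :* (yᵢ :+ :- (y :* r :* zᵢ)))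
                      refl a (x k) b (y k) r (x i) (y i) (z i)

      from-linear : Linear from
      from-linear a x b y i with i FinP.≟ k
      ... | yes _ = solve 5 (λ a x b y r → (a :* x :+ b :* y) :* r := a :* (x :* r) :+ b :* (y :* r))
                      refl a (x k) b (y k) (z k)
      ... | no _ = solve 7 (λ a x b y xᵢ yᵢ zᵢ → (a :* xᵢ :+ b :* yᵢ) :+ (a :* x :+ b :* y) :* zᵢ
                      := a :* (xᵢ :+ x :* zᵢ) :+ b :* (yᵢ :+ y :* zᵢ))
                      refl a (x k) b (y k) (x i) (y i) (z i)

      from∘to : ∀ x → from (to x) ≐ x
      from∘to x i with i FinP.≟ k
      ... | yes ≡.refl = begin
        to x i * z i      ≈⟨ *-congʳ (to-at-k x) ⟩
        x i * r * z i     ≈⟨ *-assoc _ _ _ ⟩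
        x i * (r * z i)   ≈⟨ *-congˡ (trans (*-comm _ _) zₖ*r≈1) ⟩
        x i * 1#          ≈⟨ *-identityʳ _ ⟩
        x i               ∎
      ... | no i≢k = begin
        to x i + to x k * z i                        ≈⟨ +-cong (to-off-k x i i≢k) (*-congʳ (to-at-k x)) ⟩
        (x i + - (x k * r * z i)) + x k * r * z i    ≈⟨ solve 2 (λ a b → (a :+ :- b) :+ b := a) refl (x i) (x k * r * z i) ⟩
        x i                                          ∎

      to∘from : ∀ x → to (from x) ≐ x
      to∘from x i with i FinP.≟ k
      ... | yes ≡.refl = begin
        from x i * r      ≈⟨ *-congʳ (from-at-k x) ⟩
        x i * z i * r     ≈⟨ *-assoc _ _ _ ⟩
        x i * (z i * r)   ≈⟨ *-congˡ zₖ*r≈1 ⟩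
        x i * 1#          ≈⟨ *-identityʳ _ ⟩
        x i               ∎
      ... | no i≢k = begin
        from x i + - (from x k * r * z i)
          ≈⟨ +-cong (from-off-k x i i≢k) (-‿cong (*-congʳ (*-congʳ (from-at-k x)))) ⟩
        (x i + x k * z i) + - (x k * z k * r * z i)
          ≈⟨ +-congˡ (-‿cong (*-congʳ (trans (*-assoc _ _ _) (trans (*-congˡ zₖ*r≈1) (*-identityʳ _))))) ⟩
        (x i + x k * z i) + - (x k * z i)             ≈⟨ solve 2 (λ a b → (a :+ b) :+ :- b := a) refl (x i) (x k * z i) ⟩
        x i                                           ∎

    to-z : to z ≐ e k
    to-z i with i FinP.≟ k
    ... | yes ≡.refl = zₖ*r≈1
    ... | no _ = trans (+-congˡ (-‿cong (trans (*-congʳ zₖ*r≈1) (*-identityˡ _)))) (-‿inverseʳ _)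

    to-fixes : ∀ w → w k ≈ 0# → to w ≐ w
    to-fixes w wₖ≈0 i with i FinP.≟ k
    ... | yes ≡.refl = trans (*-congʳ wₖ≈0) (trans (zeroˡ _) (sym wₖ≈0))
    ... | no _ = trans (+-congˡ (-‿cong (trans (*-congʳ (*-congʳ wₖ≈0)) (trans (*-congʳ (zeroˡ _)) (zeroˡ _)))))
                       (trans (+-congˡ -0#≈0#) (+-identityʳ _))

  independent-to : ∀ (A : Automorphism) {u v} → Independent u v →
    Independent (Automorphism.to A u) (Automorphism.to A v)
  independent-to A {u} {v} ind a b z = ind a b (Action.IsZero-to⁻ A (λ i → trans (Automorphism.to-linear A a u b v i) (z i)))

  nonzero-coordinate : ∀ {w} → ¬ IsZero w → ∃ λ k → w k ≉ 0#
  nonzero-coordinate {w} w≉0 = FinP.¬∀⟶∃¬ 4 (λ k → w k ≈ 0#) (λ k → w k ≟ 0#) w≉0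

  -- Send u to e₀ by a pivot and a swap, then the image of v, which is independent of e₀,
  -- to e₁ by a pivot at a coordinate k' ≠ 0 (fixing e₀) and a swap.
  standard-frame : ∀ u v → Independent u v →
    Σ Automorphism λ A → (Automorphism.to A u ≐ e i₀) × (Automorphism.to A v ≐ e i₁)
  standard-frame u v ind = A ⨾ B , u↦e₀ , v↦e₁
    where
    k = proj₁ (nonzero-coordinate (independent⇒≉0 ind))
    module P₁ = Pivot k u (proj₂ (nonzero-coordinate (independent⇒≉0 ind)))
    A = P₁.automorphism ⨾ swap i₀ k
    open Automorphism A using () renaming (to to toA)
    Au≐e₀ : toA u ≐ e i₀
    Au≐e₀ = ≐-trans (Automorphism.to-cong (swap i₀ k) P₁.to-z) (swap-e-fst i₀ k)
    v' = toA v
    e₀,v'-independent : Independent (e i₀) v'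
    e₀,v'-independent = independent-resp-≐ Au≐e₀ (λ _ → refl) (independent-to A ind)
    v'-off-0 : ∃ λ (k'' : Fin 3) → v' (Fin.suc k'') ≉ 0#
    v'-off-0 = FinP.¬∀⟶∃¬ 3 (λ k → v' (Fin.suc k) ≈ 0#) (λ k → v' (Fin.suc k) ≟ 0#) v'∉⟨e₀⟩
      where
      v'∉⟨e₀⟩ : ¬ (∀ k'' → v' (Fin.suc k'') ≈ 0#)
      v'∉⟨e₀⟩ v'≈0 = 1≉0 (trans (sym (-‿involutive _)) (trans (-‿cong -1≈0) -0#≈0#))
        where
        v'₀e₀-v'≈0 : IsZero (lc (v' i₀) (e i₀) (- 1#) v')
        v'₀e₀-v'≈0 Fin.zero = trans (+-cong (*-congˡ (e-diag i₀)) (sym (-‿distribˡ-* 1# _)))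
          (trans (+-cong (*-identityʳ _) (-‿cong (*-identityˡ _))) (-‿inverseʳ _))
        v'₀e₀-v'≈0 (Fin.suc j) = trans (+-cong (trans (*-congˡ (e-off i₀ (Fin.suc j) (λ ()))) (zeroʳ _))
          (trans (*-congˡ (v'≈0 j)) (zeroʳ _))) (+-identityʳ _)
        -1≈0 : - 1# ≈ 0#
        -1≈0 = proj₂ (e₀,v'-independent (v' i₀) (- 1#) v'₀e₀-v'≈0)
    k' = Fin.suc (proj₁ v'-off-0)
    module P₂ = Pivot k' v' (proj₂ v'-off-0)
    B = P₂.automorphism ⨾ swap i₁ k'
    u↦e₀ : Automorphism.to (A ⨾ B) u ≐ e i₀
    u↦e₀ = ≐-trans (Automorphism.to-cong (swap i₁ k') (Automorphism.to-cong P₂.automorphism Au≐e₀))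
      (≐-trans (Automorphism.to-cong (swap i₁ k') (P₂.to-fixes (e i₀) (e-off i₀ k' (λ ()))))
        (swap-e-other i₁ k' i₀ (λ ()) (λ ())))
    v↦e₁ : Automorphism.to (A ⨾ B) v ≐ e i₁
    v↦e₁ = ≐-trans (Automorphism.to-cong (swap i₁ k') P₂.to-z) (swap-e-fst i₁ k')

  -- The standard line L₀ = ⟨e₀, e₁⟩

  OnL₀ : V → Set
  OnL₀ w = (w i₂ ≈ 0#) × (w i₃ ≈ 0#)

  ThroughL₀ : V → Set
  ThroughL₀ f = (f i₀ ≈ 0#) × (f i₁ ≈ 0#)

  onL₀? : ∀ w → Dec (OnL₀ w)
  onL₀? w = (w i₂ ≟ 0#) ×-dec (w i₃ ≟ 0#)

  dot-throughL₀ : ∀ f w → ThroughL₀ f → dot f w ≈ f i₂ * w i₂ + f i₃ * w i₃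
  dot-throughL₀ f w (f₀≈0 , f₁≈0) = begin
    f i₀ * w i₀ + (f i₁ * w i₁ + (f i₂ * w i₂ + f i₃ * w i₃))
      ≈⟨ +-cong (*-congʳ f₀≈0) (+-congʳ (*-congʳ f₁≈0)) ⟩
    0# * w i₀ + (0# * w i₁ + (f i₂ * w i₂ + f i₃ * w i₃))      ≈⟨ solve 6 (λ a b c d e g →
        con (+ 0) :* a :+ (con (+ 0) :* b :+ (c :* d :+ e :* g)) := c :* d :+ e :* g)
        refl (w i₀) (w i₁) (f i₂) (w i₂) (f i₃) (w i₃) ⟩
    f i₂ * w i₂ + f i₃ * w i₃                                  ∎

  dot-onL₀ : ∀ f w → OnL₀ w → dot f w ≈ f i₀ * w i₀ + f i₁ * w i₁
  dot-onL₀ f w (w₂≈0 , w₃≈0) = begin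
    f i₀ * w i₀ + (f i₁ * w i₁ + (f i₂ * w i₂ + f i₃ * w i₃))
      ≈⟨ +-congˡ (+-congˡ (+-cong (*-congˡ w₂≈0) (*-congˡ w₃≈0))) ⟩
    f i₀ * w i₀ + (f i₁ * w i₁ + (f i₂ * 0# + f i₃ * 0#))      ≈⟨ solve 6 (λ a b c d e g →
        a :* b :+ (c :* d :+ (e :* con (+ 0) :+ g :* con (+ 0))) := a :* b :+ c :* d)
        refl (f i₀) (w i₀) (f i₁) (w i₁) (f i₂) (f i₃) ⟩
    f i₀ * w i₀ + f i₁ * w i₁                                  ∎

  span-⊥ : ∀ f {x y w} → Span x y w → dot f x ≈ 0# → dot f y ≈ 0# → dot f w ≈ 0#
  span-⊥ f {x} {y} {w} (a , b , w≐) f⊥x f⊥y = begin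
    dot f w                      ≈⟨ dot-congʳ f w≐ ⟩
    dot f (lc a x b y)           ≈⟨ dot-lc f a x b y ⟩
    a * dot f x + b * dot f y    ≈⟨ +-cong (*-congˡ f⊥x) (*-congˡ f⊥y) ⟩
    a * 0# + b * 0#              ≈⟨ x*0+y*0≈0 a b ⟩
    0#                           ∎

  onL₀-NonZero₂ : ∀ {w} → OnL₀ w → ¬ IsZero w → NonZero₂ (w i₀) (w i₁)
  onL₀-NonZero₂ (w₂≈0 , w₃≈0) w≉0 (w₀≈0 , w₁≈0) = w≉0 λ
    { Fin.zero → w₀≈0 ; (Fin.suc Fin.zero) → w₁≈0 ; (Fin.suc (Fin.suc Fin.zero)) → w₂≈0
    ; (Fin.suc (Fin.suc (Fin.suc Fin.zero))) → w₃≈0 }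

  throughL₀-NonZero₂ : ∀ {f} → ThroughL₀ f → ¬ IsZero f → NonZero₂ (f i₂) (f i₃)
  throughL₀-NonZero₂ (f₀≈0 , f₁≈0) f≉0 (f₂≈0 , f₃≈0) = f≉0 λ
    { Fin.zero → f₀≈0 ; (Fin.suc Fin.zero) → f₁≈0 ; (Fin.suc (Fin.suc Fin.zero)) → f₂≈0
    ; (Fin.suc (Fin.suc (Fin.suc Fin.zero))) → f₃≈0 }

  Proportional : V → V → Carrier → Set
  Proportional w w' c = ∀ i → w i ≈ c * w' i

  proportional-by-coordinates : ∀ {w w' : V} c → w i₀ ≈ c * w' i₀ → w i₁ ≈ c * w' i₁ →
    w i₂ ≈ c * w' i₂ → w i₃ ≈ c * w' i₃ → Proportional w w' c
  proportional-by-coordinates c w₀≈ w₁≈ w₂≈ w₃≈ Fin.zero = w₀≈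
  proportional-by-coordinates c w₀≈ w₁≈ w₂≈ w₃≈ (Fin.suc Fin.zero) = w₁≈
  proportional-by-coordinates c w₀≈ w₁≈ w₂≈ w₃≈ (Fin.suc (Fin.suc Fin.zero)) = w₂≈
  proportional-by-coordinates c w₀≈ w₁≈ w₂≈ w₃≈ (Fin.suc (Fin.suc (Fin.suc Fin.zero))) = w₃≈

  zero≈c*zero : ∀ {a b} c → a ≈ 0# → b ≈ 0# → a ≈ c * b
  zero≈c*zero c a≈0 b≈0 = trans a≈0 (sym (trans (*-congˡ b≈0) (zeroʳ _)))

  onL₀-proportional : ∀ {w w'} → OnL₀ w → OnL₀ w' → Proportional₂ (w i₀) (w i₁) (w' i₀) (w' i₁) →
    ∃ (Proportional w w')
  onL₀-proportional (w₂≈0 , w₃≈0) (w'₂≈0 , w'₃≈0) (c , w₀≈ , w₁≈) =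
    c , proportional-by-coordinates c w₀≈ w₁≈ (zero≈c*zero c w₂≈0 w'₂≈0) (zero≈c*zero c w₃≈0 w'₃≈0)

  throughL₀-proportional : ∀ {f f'} → ThroughL₀ f → ThroughL₀ f' → Proportional₂ (f i₂) (f i₃) (f' i₂) (f' i₃) →
    ∃ (Proportional f f')
  throughL₀-proportional (f₀≈0 , f₁≈0) (f'₀≈0 , f'₁≈0) (c , f₂≈ , f₃≈) =
    c , proportional-by-coordinates c (zero≈c*zero c f₀≈0 f'₀≈0) (zero≈c*zero c f₁≈0 f'₁≈0) f₂≈ f₃≈

  onL₀-span : ∀ {w} → OnL₀ w → Span (e i₀) (e i₁) w
  onL₀-span {w} (w₂≈0 , w₃≈0) = w i₀ , w i₁ , λ
    { Fin.zero → solve 2 (λ a b → a := a :* con (+ 1) :+ b :* con (+ 0)) refl (w i₀) (w i₁)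
    ; (Fin.suc Fin.zero) → solve 2 (λ a b → b := a :* con (+ 0) :+ b :* con (+ 1)) refl (w i₀) (w i₁)
    ; (Fin.suc (Fin.suc Fin.zero)) → trans w₂≈0 (sym (x*0+y*0≈0 (w i₀) (w i₁)))
    ; (Fin.suc (Fin.suc (Fin.suc Fin.zero))) → trans w₃≈0 (sym (x*0+y*0≈0 (w i₀) (w i₁))) }

  L₀⊆span : ∀ {x y} → Independent x y → OnL₀ x → OnL₀ y → Span x y (e i₀) × Span x y (e i₁)
  L₀⊆span ind x∈L₀ y∈L₀ = span-exchange ind (onL₀-span x∈L₀) (onL₀-span y∈L₀)

  independent-onL₀-offL₀ : ∀ {P W} → OnL₀ P → ¬ IsZero P → ¬ OnL₀ W → Independent P W
  independent-onL₀-offL₀ {P} {W} (P₂≈0 , P₃≈0) P≉0 W∉L₀ a b z = a≈0 , b≈0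
    where
    bW≈0 : ∀ i → P i ≈ 0# → b * W i ≈ 0#
    bW≈0 i Pᵢ≈0 = trans (sym (trans (+-congʳ (trans (*-congˡ Pᵢ≈0) (zeroʳ _))) (+-identityˡ _))) (z i)
    b≈0 : b ≈ 0#
    b≈0 with b ≟ 0#
    ... | yes b≈0 = b≈0
    ... | no b≉0 = ⊥-elim (W∉L₀ (x*y≈0⇒y≈0 b≉0 (bW≈0 i₂ P₂≈0) , x*y≈0⇒y≈0 b≉0 (bW≈0 i₃ P₃≈0)))
    a≈0 : a ≈ 0#
    a≈0 with a ≟ 0#
    ... | yes a≈0 = a≈0
    ... | no a≉0 = ⊥-elim (P≉0 λ i → x*y≈0⇒y≈0 a≉0
      (trans (sym (trans (+-congˡ (trans (*-congʳ b≈0) (zeroˡ _))) (+-identityʳ _))) (z i)))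

  proportional⇒factor≉0 : ∀ {w w' c} → ¬ IsZero w → Proportional w w' c → c ≉ 0#
  proportional⇒factor≉0 w≉0 w≈cw' c≈0 = w≉0 λ i → trans (w≈cw' i) (trans (*-congʳ c≈0) (zeroˡ _))

  proportional-sym : ∀ {w w' c} → ¬ IsZero w → Proportional w w' c → Proportional w' w (c ⁻¹)
  proportional-sym {w} {w'} {c} w≉0 w≈cw' i =
    sym (trans (*-congˡ (w≈cw' i)) (x⁻¹*[x*y]≈y (w' i) (proportional⇒factor≉0 w≉0 w≈cw')))

  proportional-trans : ∀ {w w' w'' c d} → Proportional w w' c → Proportional w' w'' d → Proportional w w'' (c * d)
  proportional-trans w≈cw' w'≈dw'' i = trans (w≈cw' i) (trans (*-congˡ (w'≈dw'' _)) (sym (*-assoc _ _ _)))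

  ≈π-sym : ∀ {π π'} → π ≈π π' → π' ≈π π
  ≈π-sym {π} (c , f≈cf') = c ⁻¹ , proportional-sym (Plane.form≠0 π) f≈cf'

  ≈π-trans : ∀ {π π' π''} → π ≈π π' → π' ≈π π'' → π ≈π π''
  ≈π-trans (c , f≈) (d , f'≈) = c * d , proportional-trans f≈ f'≈

  ≈ₚ-sym : ∀ {P P'} → P ≈ₚ P' → P' ≈ₚ P
  ≈ₚ-sym {P} (c , v≈cv') = c ⁻¹ , proportional-sym (Point.vec≠0 P) v≈cv'

  ≈ₚ-trans : ∀ {P P' P''} → P ≈ₚ P' → P' ≈ₚ P'' → P ≈ₚ P''
  ≈ₚ-trans (c , v≈) (d , v'≈) = c * d , proportional-trans v≈ v'≈

  ⊥-resp-≈π : ∀ {π π'} w → π ≈π π' → dot (Plane.form π) w ≈ 0# → dot (Plane.form π') w ≈ 0#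
  ⊥-resp-≈π {π} {π'} w (c , f≈cf') f⊥w = x*y≈0⇒y≈0 (proportional⇒factor≉0 (Plane.form≠0 π) f≈cf')
    (trans (sym (dot-*ˡ c (Plane.form π') w)) (trans (sym (dot-congˡ w f≈cf')) f⊥w))

  -- A chamber (Q, h, τ) has Q = ⟨Qv⟩, h = ⟨hu, hv⟩ and τ = ker τf.
  Qv τf hu hv : Chamber → V
  Qv C = Point.vec (pt C)
  τf C = Plane.form (pl C)
  hu C = Line.u (ln C)
  hv C = Line.v (ln C)

  Q∈h : ∀ C → Span (hu C) (hv C) (Qv C)
  Q∈h C = pt∈ln C

  h-independent : ∀ C → Independent (hu C) (hv C)
  h-independent C = Line.indep (ln C)

  Qv≉0 : ∀ C → ¬ IsZero (Qv C)
  Qv≉0 C = Point.vec≠0 (pt C)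

  τf≉0 : ∀ C → ¬ IsZero (τf C)
  τf≉0 C = Plane.form≠0 (pl C)

  h⊆τ : ∀ C {w} → Span (hu C) (hv C) w → dot (τf C) w ≈ 0#
  h⊆τ C w∈h = span-⊥ (τf C) w∈h (proj₁ (ln⊆pl C)) (proj₂ (ln⊆pl C))

  h⊆τ-throughL₀ : ∀ C {w} → ThroughL₀ (τf C) → Span (hu C) (hv C) w →
    τf C i₂ * w i₂ + τf C i₃ * w i₃ ≈ 0#
  h⊆τ-throughL₀ C {w} τ⊇L₀ w∈h = trans (sym (dot-throughL₀ (τf C) w τ⊇L₀)) (h⊆τ C w∈h)

  dot-onL₀≈0 : ∀ f w → OnL₀ w → dot f w ≈ 0# → f i₀ * w i₀ + f i₁ * w i₁ ≈ 0#
  dot-onL₀≈0 f w w∈L₀ f⊥w = trans (sym (dot-onL₀ f w w∈L₀)) f⊥w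

  data PositionToL₀ (C : Chamber) : Set where
    inside : OnL₀ (hu C) → OnL₀ (hv C) → PositionToL₀ C
    leaving : (w : V) → ¬ OnL₀ w → Span (hu C) (hv C) w → PositionToL₀ C

  positionToL₀ : ∀ C → PositionToL₀ C
  positionToL₀ C with onL₀? (hu C) | onL₀? (hv C)
  ... | yes u∈L₀ | yes v∈L₀ = inside u∈L₀ v∈L₀
  ... | no u∉L₀ | _ = leaving (hu C) u∉L₀ (span-fst _ _)
  ... | yes _ | no v∉L₀ = leaving (hv C) v∉L₀ (span-snd _ _)

  ≈ₗ-if-insideL₀ : ∀ C D → OnL₀ (hu C) → OnL₀ (hv C) → OnL₀ (hu D) → OnL₀ (hv D) → ln C ≈ₗ ln D
  ≈ₗ-if-insideL₀ C D u∈L₀ v∈L₀ u'∈L₀ v'∈L₀ =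
    ≈ₗ-by-independent (ln C) (ln D) (h-independent C) (span-fst _ _) (span-snd _ _)
      (span-trans (onL₀-span u∈L₀) e₀∈h' e₁∈h') (span-trans (onL₀-span v∈L₀) e₀∈h' e₁∈h')
    where
    e₀∈h' = proj₁ (L₀⊆span (h-independent D) u'∈L₀ v'∈L₀)
    e₁∈h' = proj₂ (L₀⊆span (h-independent D) u'∈L₀ v'∈L₀)

  -- (a) Q ∈ L₀ ⊆ τ

  det₀₁ : V → V → Carrier
  det₀₁ x y = det (x i₀) (x i₁) (y i₀) (y i₁)

  -- For Q ∈ L₀ and a plane τ ⊇ L₀, the lines ⟨Q, w⟩ ⊆ τ with w ∉ L₀ are told apart by this
  -- normalised determinant: it does not depend on the representatives of Q and of the line.
  slope : V → V → Carrier
  slope Q w = det₀₁ Q w * (pivot (Q i₀) (Q i₁) * pivot (w i₂) (w i₃)) ⁻¹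

  slope-injective : ∀ {Q Q' w w' α} → Proportional Q Q' α → OnL₀ Q' →
    NonZero₂ (Q i₀) (Q i₁) → NonZero₂ (Q' i₀) (Q' i₁) → ¬ OnL₀ w → ¬ OnL₀ w' →
    Proportional₂ (w i₂) (w i₃) (w' i₂) (w' i₃) → slope Q w ≈ slope Q' w' → Span Q' w' w
  slope-injective {Q} {Q'} {w} {w'} {α} Q≈αQ' (Q'₂≈0 , Q'₃≈0) Q≉0 Q'≉0 w∉L₀ w'∉L₀ (λ′ , w₂≈ , w₃≈)
    slopes≈ = μ , λ′ , w≐
    where
    α≉0 : α ≉ 0#
    α≉0 = proportional₂⇒factor≉0 Q≉0 (Q≈αQ' i₀) (Q≈αQ' i₁)
    s≈ : pivot (Q i₀) (Q i₁) * pivot (w i₂) (w i₃) ≈ (α * λ′) * (pivot (Q' i₀) (Q' i₁) * pivot (w' i₂) (w' i₃))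
    s≈ = trans (*-cong (pivot-* Q≉0 Q'≉0 (Q≈αQ' i₀) (Q≈αQ' i₁)) (pivot-* w∉L₀ w'∉L₀ w₂≈ w₃≈))
      (solve 4 (λ a b c d → a :* b :* (c :* d) := a :* c :* (b :* d)) refl α _ λ′ _)
    det-Q-w≈ : det₀₁ Q w ≈ (α * λ′) * det₀₁ Q' w'
    det-Q-w≈ = x/s≈x'/s'⇒x≈l*x' (*-≉0 (pivot≉0 Q≉0) (pivot≉0 w∉L₀)) (*-≉0 (pivot≉0 Q'≉0) (pivot≉0 w'∉L₀))
      s≈ slopes≈
    det-Q-w≈α* : det₀₁ Q w ≈ α * det₀₁ Q' w
    det-Q-w≈α* = trans (+-cong (*-congʳ (Q≈αQ' i₀)) (-‿cong (*-congʳ (Q≈αQ' i₁))))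
      (solve 5 (λ a q₀ q₁ w₀ w₁ → a :* q₀ :* w₁ :+ :- (a :* q₁ :* w₀) := a :* (q₀ :* w₁ :+ :- (q₁ :* w₀)))
        refl α (Q' i₀) (Q' i₁) (w i₀) (w i₁))
    det-Q'-w≈ : det₀₁ Q' w ≈ λ′ * det₀₁ Q' w'
    det-Q'-w≈ = *-cancelˡ α≉0 (trans (sym det-Q-w≈α*) (trans det-Q-w≈ (*-assoc _ _ _)))
    det-Q'-[w-λw']≈0 : det (Q' i₀) (Q' i₁) (w i₀ + - (λ′ * w' i₀)) (w i₁ + - (λ′ * w' i₁)) ≈ 0#
    det-Q'-[w-λw']≈0 = begin
      det (Q' i₀) (Q' i₁) (w i₀ + - (λ′ * w' i₀)) (w i₁ + - (λ′ * w' i₁))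
        ≈⟨ solve 7 (λ q₀ q₁ w₀ w₁ l v₀ v₁ → q₀ :* (w₁ :+ :- (l :* v₁)) :+ :- (q₁ :* (w₀ :+ :- (l :* v₀)))
             := (q₀ :* w₁ :+ :- (q₁ :* w₀)) :+ :- (l :* (q₀ :* v₁ :+ :- (q₁ :* v₀))))
             refl (Q' i₀) (Q' i₁) (w i₀) (w i₁) λ′ (w' i₀) (w' i₁) ⟩
      det₀₁ Q' w + - (λ′ * det₀₁ Q' w')   ≈⟨ x≈y⇒x-y≈0 det-Q'-w≈ ⟩
      0#                                  ∎
    w-λw'∝Q' = det≈0⇒proportional (Q' i₀) (Q' i₁) _ _ Q'≉0 det-Q'-[w-λw']≈0
    μ = proj₁ w-λw'∝Q'
    x-y≈z⇒x≈z+y : ∀ {x y z} → x + - y ≈ z → x ≈ z + y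
    x-y≈z⇒x≈z+y {x} {y} x-y≈z = trans (solve 2 (λ x y → x := (x :+ :- y) :+ y) refl x y) (+-congʳ x-y≈z)
    drop-Q' : ∀ {x y} → x ≈ 0# → μ * x + y ≈ y
    drop-Q' x≈0 = trans (+-congʳ (trans (*-congˡ x≈0) (zeroʳ _))) (+-identityˡ _)
    w≐ : w ≐ lc μ Q' λ′ w'
    w≐ Fin.zero = x-y≈z⇒x≈z+y (proj₁ (proj₂ w-λw'∝Q'))
    w≐ (Fin.suc Fin.zero) = x-y≈z⇒x≈z+y (proj₂ (proj₂ w-λw'∝Q'))
    w≐ (Fin.suc (Fin.suc Fin.zero)) = trans w₂≈ (sym (drop-Q' Q'₂≈0))
    w≐ (Fin.suc (Fin.suc (Fin.suc Fin.zero))) = trans w₃≈ (sym (drop-Q' Q'₃≈0))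

  Q∈L₀⊆τ : Chamber → Set
  Q∈L₀⊆τ C = OnL₀ (Qv C) × ThroughL₀ (τf C)

  line-code : ∀ {C} → PositionToL₀ C → Fin (suc q)
  line-code (inside _ _) = Fin.zero
  line-code {C} (leaving w _ _) = Fin.suc (index (slope (Qv C) w))

  code-Q∈L₀⊆τ : ∀ C → Q∈L₀⊆τ C → Fin (suc q ℕ.* (suc q ℕ.* suc q))
  code-Q∈L₀⊆τ C _ = Fin.combine (pcode (Qv C i₀) (Qv C i₁))
    (Fin.combine (pcode (τf C i₂) (τf C i₃)) (line-code (positionToL₀ C)))

  code-Q∈L₀⊆τ-injective : ∀ C D (c : Q∈L₀⊆τ C) (d : Q∈L₀⊆τ D) →
    code-Q∈L₀⊆τ C c ≡ code-Q∈L₀⊆τ D d → C ≈ᶜ D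
  code-Q∈L₀⊆τ-injective C D (Q∈L₀ , τ⊇L₀) (Q'∈L₀ , τ'⊇L₀) same =
    Q≈ , h≈ (positionToL₀ C) (positionToL₀ D) same-line , τ≈
    where
    same-Q,rest = FinP.combine-injective _ _ _ _ same
    same-τ,line = FinP.combine-injective _ _ _ _ (proj₂ same-Q,rest)
    same-line = proj₂ same-τ,line
    Q≉0 = onL₀-NonZero₂ Q∈L₀ (Qv≉0 C)
    Q'≉0 = onL₀-NonZero₂ Q'∈L₀ (Qv≉0 D)
    τ≉0 = throughL₀-NonZero₂ τ⊇L₀ (τf≉0 C)
    τ'≉0 = throughL₀-NonZero₂ τ'⊇L₀ (τf≉0 D)
    Q≈ = onL₀-proportional Q∈L₀ Q'∈L₀ (pcode-injective Q≉0 Q'≉0 (proj₁ same-Q,rest))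
    τ≈ = throughL₀-proportional τ⊇L₀ τ'⊇L₀ (pcode-injective τ≉0 τ'≉0 (proj₁ same-τ,line))
    α = proj₁ Q≈
    h≈ : ∀ (p : PositionToL₀ C) (p' : PositionToL₀ D) → line-code p ≡ line-code p' → ln C ≈ₗ ln D
    h≈ (inside u∈L₀ v∈L₀) (inside u'∈L₀ v'∈L₀) _ = ≈ₗ-if-insideL₀ C D u∈L₀ v∈L₀ u'∈L₀ v'∈L₀
    h≈ (inside _ _) (leaving _ _ _) ()
    h≈ (leaving _ _ _) (inside _ _) ()
    h≈ (leaving w w∉L₀ w∈h) (leaving w' w'∉L₀ w'∈h') same-slope =
      ≈ₗ-by-independent (ln C) (ln D) (independent-onL₀-offL₀ Q∈L₀ (Qv≉0 C) w∉L₀) (Q∈h C) w∈h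
        (span-proportional α (proj₂ Q≈) (Q∈h D)) (span-trans w∈⟨Q',w'⟩ (Q∈h D) w'∈h')
      where
      w⊥τ' : τf D i₂ * w i₂ + τf D i₃ * w i₃ ≈ 0#
      w⊥τ' = trans (sym (dot-throughL₀ (τf D) w τ'⊇L₀)) (⊥-resp-≈π {pl C} {pl D} w τ≈ (h⊆τ C w∈h))
      w∈⟨Q',w'⟩ : Span (Qv D) w' w
      w∈⟨Q',w'⟩ = slope-injective (proj₂ Q≈) Q'∈L₀ Q≉0 Q'≉0 w∉L₀ w'∉L₀
        (⊥-common⇒proportional (w' i₂) (w' i₃) (w i₂) (w i₃) τ'≉0 w'∉L₀
          (h⊆τ-throughL₀ D τ'⊇L₀ w'∈h') w⊥τ')
        (index-injective (FinP.suc-injective same-slope))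

  count-Q∈L₀⊆τ : ∀ cs → All Q∈L₀⊆τ cs → AllPairs (λ C D → ¬ (C ≈ᶜ D)) cs →
    length cs ≤ suc q ℕ.* (suc q ℕ.* suc q)
  count-Q∈L₀⊆τ = length≤-by-code code-Q∈L₀⊆τ code-Q∈L₀⊆τ-injective

  -- (b) Q ∉ L₀ ⊆ τ

  -- A plane through L₀ is spanned by L₀ and any one vector outside L₀.
  ≈π-by-offL₀ : ∀ C D w → ThroughL₀ (τf C) → ThroughL₀ (τf D) → ¬ OnL₀ w →
    dot (τf C) w ≈ 0# → dot (τf D) w ≈ 0# → pl C ≈π pl D
  ≈π-by-offL₀ C D w τ⊇L₀ τ'⊇L₀ w∉L₀ f⊥w f'⊥w =
    throughL₀-proportional τ⊇L₀ τ'⊇L₀ (⊥-common⇒proportional (τf D i₂) (τf D i₃) (τf C i₂) (τf C i₃) w∉L₀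
      (throughL₀-NonZero₂ τ'⊇L₀ (τf≉0 D)) (⊥₂-comm (trans (sym (dot-throughL₀ (τf D) w τ'⊇L₀)) f'⊥w))
      (⊥₂-comm (trans (sym (dot-throughL₀ (τf C) w τ⊇L₀)) f⊥w)))

  PointOfL₀ : V → Set
  PointOfL₀ P = OnL₀ P × ¬ IsZero P

  -- h and L₀ lie in the plane τ, so they meet: if u ∉ L₀ then v - μ u ∈ L₀ where v₂₃ = μ u₂₃.
  h∩L₀ : ∀ C → ThroughL₀ (τf C) → Σ V λ P → PointOfL₀ P × Span (hu C) (hv C) P
  h∩L₀ C τ⊇L₀ with onL₀? (hu C)
  ... | yes u∈L₀ = hu C , (u∈L₀ , independent⇒≉0 (h-independent C)) , span-fst _ _
  ... | no u∉L₀ = lc (- μ) (hu C) 1# (hv C) , ((v-μu₂≈0 , v-μu₃≈0) , v-μu≉0) , (- μ , 1# , λ _ → refl)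
    where
    v∝u = ⊥-common⇒proportional (hu C i₂) (hu C i₃) (hv C i₂) (hv C i₃)
      (throughL₀-NonZero₂ τ⊇L₀ (τf≉0 C)) u∉L₀
      (h⊆τ-throughL₀ C τ⊇L₀ (span-fst _ _)) (h⊆τ-throughL₀ C τ⊇L₀ (span-snd _ _))
    μ = proj₁ v∝u
    -μx+y≈0 : ∀ {x y} → y ≈ μ * x → - μ * x + 1# * y ≈ 0#
    -μx+y≈0 {x} {y} y≈μx =
      trans (+-cong (sym (-‿distribˡ-* μ x)) (trans (*-identityˡ y) y≈μx)) (trans (+-comm _ _) (-‿inverseʳ _))
    v-μu₂≈0 = -μx+y≈0 (proj₁ (proj₂ v∝u))
    v-μu₃≈0 = -μx+y≈0 (proj₂ (proj₂ v∝u))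
    v-μu≉0 : ¬ IsZero (lc (- μ) (hu C) 1# (hv C))
    v-μu≉0 v-μu≈0 = 1≉0 (proj₂ (h-independent C (- μ) 1# v-μu≈0))

  meet : ∀ C → ThroughL₀ (τf C) → V
  meet C τ⊇L₀ = proj₁ (h∩L₀ C τ⊇L₀)

  meet-point : ∀ C τ⊇L₀ → PointOfL₀ (meet C τ⊇L₀)
  meet-point C τ⊇L₀ = proj₁ (proj₂ (h∩L₀ C τ⊇L₀))

  meet∈h : ∀ C τ⊇L₀ → Span (hu C) (hv C) (meet C τ⊇L₀)
  meet∈h C τ⊇L₀ = proj₂ (proj₂ (h∩L₀ C τ⊇L₀))

  h∩L₀-unique : ∀ C {P w} → ¬ OnL₀ (Qv C) → PointOfL₀ P → Span (hu C) (hv C) P →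
    Span (hu C) (hv C) w → OnL₀ w → ∃ (Proportional w P)
  h∩L₀-unique C {P} {w} Q∉L₀ (P∈L₀ , P≉0) P∈h w∈h (w₂≈0 , w₃≈0) = a , w≈aP
    where
    h⊆⟨P,Q⟩ = span-exchange (independent-onL₀-offL₀ P∈L₀ P≉0 Q∉L₀) P∈h (Q∈h C)
    w∈⟨P,Q⟩ = span-trans w∈h (proj₁ h⊆⟨P,Q⟩) (proj₂ h⊆⟨P,Q⟩)
    a = proj₁ w∈⟨P,Q⟩
    b = proj₁ (proj₂ w∈⟨P,Q⟩)
    w≐ = proj₂ (proj₂ w∈⟨P,Q⟩)
    bQ≈0 : ∀ i → w i ≈ 0# → P i ≈ 0# → b * Qv C i ≈ 0#
    bQ≈0 i wᵢ≈0 Pᵢ≈0 =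
      trans (sym (trans (+-congʳ (trans (*-congˡ Pᵢ≈0) (zeroʳ _))) (+-identityˡ _))) (trans (sym (w≐ i)) wᵢ≈0)
    b≈0 : b ≈ 0#
    b≈0 with b ≟ 0#
    ... | yes b≈0 = b≈0
    ... | no b≉0 = ⊥-elim (Q∉L₀ ( x*y≈0⇒y≈0 b≉0 (bQ≈0 i₂ w₂≈0 (proj₁ P∈L₀))
                                , x*y≈0⇒y≈0 b≉0 (bQ≈0 i₃ w₃≈0 (proj₂ P∈L₀))))
    w≈aP : Proportional w P a
    w≈aP i = trans (w≐ i) (trans (+-congˡ (trans (*-congʳ b≈0) (zeroˡ _))) (+-identityʳ _))

  Q∉L₀⊆τ : Chamber → Set
  Q∉L₀⊆τ C = ¬ OnL₀ (Qv C) × ThroughL₀ (τf C)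

  -- Both planes contain L₀, so any vector of both lies in L₀ or makes the planes equal; the
  -- common points in L₀ are then multiples of P.
  ¬opposite⇒shared-point : ∀ C E → Q∉L₀⊆τ C → Q∉L₀⊆τ E → ¬ (pl C ≈π pl E) →
    ∀ {P} → PointOfL₀ P → Span (hu C) (hv C) P → ¬ Opposite C E → ¬ ¬ Span (hu E) (hv E) P
  ¬opposite⇒shared-point C E (Q∉L₀ , τ⊇L₀) (Q'∉L₀ , τ'⊇L₀) τ≉τ' {P} P∈L₀ P∈h ¬opposite P∉h' =
    ¬opposite (Q∉τ' , disjoint , Q'∉τ)
    where
    Q∉τ' : ¬ (pt C ∈π pl E)
    Q∉τ' Q∈τ' = τ≉τ' (≈π-by-offL₀ C E (Qv C) τ⊇L₀ τ'⊇L₀ Q∉L₀ (h⊆τ C (Q∈h C)) Q∈τ')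
    Q'∉τ : ¬ (pt E ∈π pl C)
    Q'∉τ Q'∈τ = τ≉τ' (≈π-by-offL₀ C E (Qv E) τ⊇L₀ τ'⊇L₀ Q'∉L₀ Q'∈τ (h⊆τ E (Q∈h E)))
    disjoint : Disjoint (ln C) (ln E)
    disjoint w w∈h w∈h' = by-position (onL₀? w)
      where
      by-factor : ∀ a → Proportional w P a → Dec (a ≈ 0#) → IsZero w
      by-factor a w≈aP (yes a≈0) i = trans (w≈aP i) (trans (*-congʳ a≈0) (zeroˡ _))
      by-factor a w≈aP (no a≉0) = ⊥-elim (P∉h' (span-proportional (a ⁻¹) P≈a⁻¹w w∈h'))
        where
        P≈a⁻¹w : Proportional P w (a ⁻¹)
        P≈a⁻¹w i = sym (trans (*-congˡ (w≈aP i)) (x⁻¹*[x*y]≈y (P i) a≉0))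
      by-position : Dec (OnL₀ w) → IsZero w
      by-position (no w∉L₀) =
        ⊥-elim (τ≉τ' (≈π-by-offL₀ C E w τ⊇L₀ τ'⊇L₀ w∉L₀ (h⊆τ C w∈h) (h⊆τ E w∈h')))
      by-position (yes w∈L₀) =
        let (a , w≈aP) = h∩L₀-unique C Q∉L₀ P∈L₀ P∈h w∈h w∈L₀ in by-factor a w≈aP (a ≟ 0#)
  LinesMeetOnL₀ : Chamber → Chamber → Set
  LinesMeetOnL₀ C D = ∃ λ P → PointOfL₀ P × Span (hu C) (hv C) P × Span (hu D) (hv D) P

  point-code : V → Fin (q ℕ.* q)
  point-code w = affine-code (w i₀) (w i₁) (w i₂) (w i₃)

  point-code-injective : ∀ {w w' l} → ¬ OnL₀ w → ¬ OnL₀ w' → w i₂ ≈ l * w' i₂ → w i₃ ≈ l * w' i₃ →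
    point-code w ≡ point-code w' → Proportional w w' l
  point-code-injective {l = l} w∉L₀ w'∉L₀ w₂≈ w₃≈ same =
    let (w₀≈ , w₁≈) = affine-code-injective w∉L₀ w'∉L₀ w₂≈ w₃≈ same
    in proportional-by-coordinates l w₀≈ w₁≈ w₂≈ w₃≈

  code-same-plane : ∀ C → Q∉L₀⊆τ C → Fin (suc q ℕ.* (q ℕ.* q))
  code-same-plane C (Q∉L₀ , τ⊇L₀) = Fin.combine (pcode (R i₀) (R i₁)) (point-code (Qv C))
    where
    R = meet C τ⊇L₀

  code-same-plane-injective : ∀ C D (c : Q∉L₀⊆τ C) (d : Q∉L₀⊆τ D) → pl C ≈π pl D →
    code-same-plane C c ≡ code-same-plane D d → C ≈ᶜ D
  code-same-plane-injective C D (Q∉L₀ , τ⊇L₀) (Q'∉L₀ , τ'⊇L₀) τ≈τ' same = Q≈Q' , h≈h' , τ≈τ'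
    where
    same-parts = FinP.combine-injective _ _ _ _ same
    R-point = meet-point C τ⊇L₀
    R'-point = meet-point D τ'⊇L₀
    R≈R' = onL₀-proportional (proj₁ R-point) (proj₁ R'-point)
      (pcode-injective (onL₀-NonZero₂ (proj₁ R-point) (proj₂ R-point)) (onL₀-NonZero₂ (proj₁ R'-point) (proj₂ R'-point))
        (proj₁ same-parts))
    Q∈τ' : τf D i₂ * Qv C i₂ + τf D i₃ * Qv C i₃ ≈ 0#
    Q∈τ' = trans (sym (dot-throughL₀ (τf D) (Qv C) τ'⊇L₀)) (⊥-resp-≈π {pl C} {pl D} (Qv C) τ≈τ' (h⊆τ C (Q∈h C)))
    Q₂₃≈ = ⊥-common⇒proportional (Qv D i₂) (Qv D i₃) (Qv C i₂) (Qv C i₃)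
      (throughL₀-NonZero₂ τ'⊇L₀ (τf≉0 D)) Q'∉L₀ (h⊆τ-throughL₀ D τ'⊇L₀ (Q∈h D)) Q∈τ'
    Q≈Q' : pt C ≈ₚ pt D
    Q≈Q' = proj₁ Q₂₃≈ , point-code-injective Q∉L₀ Q'∉L₀ (proj₁ (proj₂ Q₂₃≈)) (proj₂ (proj₂ Q₂₃≈)) (proj₂ same-parts)
    h≈h' : ln C ≈ₗ ln D
    h≈h' = ≈ₗ-by-independent (ln C) (ln D) (independent-onL₀-offL₀ (proj₁ R-point) (proj₂ R-point) Q∉L₀)
      (meet∈h C τ⊇L₀) (Q∈h C)
      (span-proportional (proj₁ R≈R') (proj₂ R≈R') (meet∈h D τ'⊇L₀))
      (span-proportional (proj₁ Q≈Q') (proj₂ Q≈Q') (Q∈h D))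

  code-meeting-lines : ∀ C → Q∉L₀⊆τ C → Fin (suc q ℕ.* (q ℕ.* q))
  code-meeting-lines C (Q∉L₀ , _) = Fin.combine (pcode (Qv C i₂) (Qv C i₃)) (point-code (Qv C))

  -- All lines meet the line h₀ of C₀ on L₀, and h₀ has only one point there (Q₀ ∉ L₀):
  -- so they pass through a common point R of L₀, and a chamber is fixed by its point.
  code-meeting-lines-injective : ∀ C₀ → Q∉L₀⊆τ C₀ → ∀ C D (c : Q∉L₀⊆τ C) (d : Q∉L₀⊆τ D) →
    LinesMeetOnL₀ C₀ C → LinesMeetOnL₀ C₀ D → code-meeting-lines C c ≡ code-meeting-lines D d → C ≈ᶜ D
  code-meeting-lines-injective C₀ (Q₀∉L₀ , _) C D (Q∉L₀ , τ⊇L₀) (Q'∉L₀ , τ'⊇L₀)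
    (R , R-point , R∈h₀ , R∈h) (R' , R'-point , R'∈h₀ , R'∈h') same = Q≈Q' , h≈h' , τ≈τ'
    where
    same-parts = FinP.combine-injective _ _ _ _ same
    Q₂₃≈ = pcode-injective Q∉L₀ Q'∉L₀ (proj₁ same-parts)
    Q≈Q' : pt C ≈ₚ pt D
    Q≈Q' = proj₁ Q₂₃≈ , point-code-injective Q∉L₀ Q'∉L₀ (proj₁ (proj₂ Q₂₃≈)) (proj₂ (proj₂ Q₂₃≈)) (proj₂ same-parts)
    R∈h' : Span (hu D) (hv D) R
    R∈h' = let (a , R≈aR') = h∩L₀-unique C₀ Q₀∉L₀ R'-point R'∈h₀ R∈h₀ (proj₁ R-point)
           in span-proportional a R≈aR' R'∈h'
    Q∈τ' : dot (τf D) (Qv C) ≈ 0#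
    Q∈τ' = trans (dot-congʳ (τf D) (proj₂ Q≈Q'))
      (trans (dot-*ʳ (τf D) _ (Qv D)) (trans (*-congˡ (h⊆τ D (Q∈h D))) (zeroʳ _)))
    τ≈τ' : pl C ≈π pl D
    τ≈τ' = ≈π-by-offL₀ C D (Qv C) τ⊇L₀ τ'⊇L₀ Q∉L₀ (h⊆τ C (Q∈h C)) Q∈τ'
    h≈h' : ln C ≈ₗ ln D
    h≈h' = ≈ₗ-by-independent (ln C) (ln D) (independent-onL₀-offL₀ (proj₁ R-point) (proj₂ R-point) Q∉L₀) R∈h (Q∈h C)
      R∈h' (span-proportional (proj₁ Q≈Q') (proj₂ Q≈Q') (Q∈h D))

  count-Q∉L₀⊆τ : ∀ (X : Chamber → Set) → PairwiseNonOpposite X →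
    ∀ cs → All (λ C → X C × Q∉L₀⊆τ C) cs → AllPairs (λ C D → ¬ (C ≈ᶜ D)) cs →
    length cs ≤ suc q ℕ.* (q ℕ.* q)
  count-Q∉L₀⊆τ X non-opposite = length≤-by-dichotomy (λ C → X C × Q∉L₀⊆τ C) (λ C D → pl C ≈π pl D)
    (λ {C} {D} → ≈π-sym {pl C} {pl D}) (λ {C} {D} {E} → ≈π-trans {pl C} {pl D} {pl E})
    LinesMeetOnL₀ meets-itself meeting-spreads bound-same-plane bound-meeting-lines
    where
    meets-itself : ∀ {C} → X C × Q∉L₀⊆τ C → LinesMeetOnL₀ C C
    meets-itself {C} (_ , _ , τ⊇L₀) = meet C τ⊇L₀ , meet-point C τ⊇L₀ , meet∈h C τ⊇L₀ , meet∈h C τ⊇L₀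
    meeting-spreads : ∀ {C D E} → X C × Q∉L₀⊆τ C → X D × Q∉L₀⊆τ D → X E × Q∉L₀⊆τ E → ¬ (pl D ≈π pl E) →
      LinesMeetOnL₀ C D → ¬ ¬ LinesMeetOnL₀ C E
    meeting-spreads {C} {D} {E} _ (X-D , d) (X-E , e) τ≉τ' (P , P-point , P∈h₀ , P∈h) =
      ¬¬-map (λ P∈h' → P , P-point , P∈h₀ , P∈h')
        (¬opposite⇒shared-point D E d e τ≉τ' P-point P∈h (non-opposite D E X-D X-E))
    bound-same-plane : ∀ C₀ → X C₀ × Q∉L₀⊆τ C₀ → ∀ cs → All (λ C → (X C × Q∉L₀⊆τ C) × pl C ≈π pl C₀) cs →
      AllPairs (λ C D → ¬ (C ≈ᶜ D)) cs → length cs ≤ suc q ℕ.* (q ℕ.* q)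
    bound-same-plane C₀ _ = length≤-by-code (λ C c → code-same-plane C (proj₂ (proj₁ c)))
      (λ C D c d → code-same-plane-injective C D (proj₂ (proj₁ c)) (proj₂ (proj₁ d))
        (≈π-trans {pl C} {pl C₀} {pl D} (proj₂ c) (≈π-sym {pl D} {pl C₀} (proj₂ d))))
    bound-meeting-lines : ∀ C₀ → X C₀ × Q∉L₀⊆τ C₀ → ∀ cs → All (λ C → (X C × Q∉L₀⊆τ C) × LinesMeetOnL₀ C₀ C) cs →
      AllPairs (λ C D → ¬ (C ≈ᶜ D)) cs → length cs ≤ suc q ℕ.* (q ℕ.* q)
    bound-meeting-lines C₀ (_ , c₀) = length≤-by-code (λ C c → code-meeting-lines C (proj₂ (proj₁ c)))
      (λ C D c d → code-meeting-lines-injective C₀ c₀ C D (proj₂ (proj₁ c)) (proj₂ (proj₁ d)) (proj₂ c) (proj₂ d))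

  -- (c) Q ∈ L₀ ⊈ τ

  Q∈L₀⊈τ : Chamber → Set
  Q∈L₀⊈τ C = OnL₀ (Qv C) × ¬ ThroughL₀ (τf C)

  Q∈τ₀₁ : ∀ C → OnL₀ (Qv C) → τf C i₀ * Qv C i₀ + τf C i₁ * Qv C i₁ ≈ 0#
  Q∈τ₀₁ C Q∈L₀ = dot-onL₀≈0 (τf C) (Qv C) Q∈L₀ (h⊆τ C (Q∈h C))

  τ∩L₀-unique : ∀ f {w w'} → ¬ ThroughL₀ f → OnL₀ w → OnL₀ w' → ¬ IsZero w →
    dot f w ≈ 0# → dot f w' ≈ 0# → ∃ (Proportional w' w)
  τ∩L₀-unique f {w} {w'} τ⊉L₀ w∈L₀ w'∈L₀ w≉0 f⊥w f⊥w' = onL₀-proportional w'∈L₀ w∈L₀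
    (⊥-common⇒proportional (w i₀) (w i₁) (w' i₀) (w' i₁) τ⊉L₀ (onL₀-NonZero₂ w∈L₀ w≉0)
      (dot-onL₀≈0 f w w∈L₀ f⊥w) (dot-onL₀≈0 f w' w'∈L₀ f⊥w'))

  h⊈L₀ : ∀ C → ¬ ThroughL₀ (τf C) → ¬ (OnL₀ (hu C) × OnL₀ (hv C))
  h⊈L₀ C τ⊉L₀ (u∈L₀ , v∈L₀) = τ⊉L₀ (τ-coordinate i₀ e₀∈h , τ-coordinate i₁ e₁∈h)
    where
    e₀∈h = proj₁ (L₀⊆span (h-independent C) u∈L₀ v∈L₀)
    e₁∈h = proj₂ (L₀⊆span (h-independent C) u∈L₀ v∈L₀)
    τ-coordinate : ∀ i → Span (hu C) (hv C) (e i) → τf C i ≈ 0#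
    τ-coordinate i eᵢ∈h = trans (sym (dot-e (τf C) i)) (h⊆τ C eᵢ∈h)

  OffL₀On : Chamber → V → Set
  OffL₀On C w = ¬ OnL₀ w × Span (hu C) (hv C) w

  h∖L₀ : ∀ C → ¬ ThroughL₀ (τf C) → ∃ (OffL₀On C)
  h∖L₀ C τ⊉L₀ with positionToL₀ C
  ... | inside u∈L₀ v∈L₀ = ⊥-elim (h⊈L₀ C τ⊉L₀ (u∈L₀ , v∈L₀))
  ... | leaving w w∉L₀ w∈h = w , w∉L₀ , w∈h

  -- Through Q ∈ L₀ the line h is ⟨Q, w⟩, so the part w₂₃ of any w ∈ h ∖ L₀ is fixed up to scalar:
  -- it is the direction of h.
  Direction : V → V → Set
  Direction w w' = Proportional₂ (w i₂) (w i₃) (w' i₂) (w' i₃)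

  span-Q,w : ∀ C {w z} → OnL₀ (Qv C) → OffL₀On C w → Span (hu C) (hv C) z → Span (Qv C) w z
  span-Q,w C Q∈L₀ (w∉L₀ , w∈h) z∈h =
    let (u∈⟨Q,w⟩ , v∈⟨Q,w⟩) = span-exchange (independent-onL₀-offL₀ Q∈L₀ (Qv≉0 C) w∉L₀) (Q∈h C) w∈h
    in span-trans z∈h u∈⟨Q,w⟩ v∈⟨Q,w⟩

  span-Q,w₂₃ : ∀ {Q w z a b} → OnL₀ Q → z ≐ lc a Q b w → (z i₂ ≈ b * w i₂) × (z i₃ ≈ b * w i₃)
  span-Q,w₂₃ (Q₂≈0 , Q₃≈0) z≐ = drop-Q Q₂≈0 (z≐ i₂) , drop-Q Q₃≈0 (z≐ i₃)
    where
    drop-Q : ∀ {a b x y z} → x ≈ 0# → z ≈ a * x + b * y → z ≈ b * y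
    drop-Q x≈0 z≈ = trans z≈ (trans (+-congʳ (trans (*-congˡ x≈0) (zeroʳ _))) (+-identityˡ _))

  direction-unique : ∀ C {w w'} → OnL₀ (Qv C) → OffL₀On C w → OffL₀On C w' → Direction w' w
  direction-unique C Q∈L₀ w-off w'-off =
    let (_ , b , w'≐) = span-Q,w C Q∈L₀ w-off (proj₂ w'-off) in b , span-Q,w₂₃ Q∈L₀ w'≐

  -- Both lines lie in τ, so w - λ w' ∈ τ ∩ L₀ = ⟨Q⟩ and w ∈ ⟨Q, w'⟩.
  ≈ₗ-by-direction : ∀ C D {w w' κ μ} → Q∈L₀⊈τ C → Q∈L₀⊈τ D → Proportional (Qv C) (Qv D) κ →
    Proportional (τf C) (τf D) μ → OffL₀On C w → OffL₀On D w' → Direction w w' → ln C ≈ₗ ln D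
  ≈ₗ-by-direction C D {w} {w'} {κ} {μ} (Q∈L₀ , τ⊉L₀) _ Q≈ τ≈ (w∉L₀ , w∈h) (_ , w'∈h')
    (λ′ , w₂≈ , w₃≈) =
    ≈ₗ-by-independent (ln C) (ln D) (independent-onL₀-offL₀ Q∈L₀ (Qv≉0 C) w∉L₀) (Q∈h C) w∈h
      Q∈h' (span-trans w∈⟨Q,w'⟩ Q∈h' w'∈h')
    where
    Q∈h' = span-proportional κ Q≈ (Q∈h D)
    z = lc 1# w (- λ′) w'
    z∈L₀ : OnL₀ z
    z∈L₀ = x-λx'≈0 w₂≈ , x-λx'≈0 w₃≈
      where
      x-λx'≈0 : ∀ {x x'} → x ≈ λ′ * x' → 1# * x + - λ′ * x' ≈ 0#
      x-λx'≈0 x≈ = trans (+-cong (trans (*-identityˡ _) x≈) (sym (-‿distribˡ-* _ _))) (-‿inverseʳ _)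
    z∈τ : dot (τf C) z ≈ 0#
    z∈τ = begin
      dot (τf C) z                                      ≈⟨ dot-lc (τf C) 1# w (- λ′) w' ⟩
      1# * dot (τf C) w + - λ′ * dot (τf C) w'          ≈⟨ +-cong (*-congˡ (h⊆τ C w∈h)) (*-congˡ w'∈τ) ⟩
      1# * 0# + - λ′ * 0#                               ≈⟨ x*0+y*0≈0 1# (- λ′) ⟩
      0#                                                ∎
      where
      w'∈τ : dot (τf C) w' ≈ 0#
      w'∈τ = trans (dot-congˡ w' τ≈) (trans (dot-*ˡ μ (τf D) w') (trans (*-congˡ (h⊆τ D w'∈h')) (zeroʳ _)))
    z∝Q = τ∩L₀-unique (τf C) τ⊉L₀ Q∈L₀ z∈L₀ (Qv≉0 C) (h⊆τ C (Q∈h C)) z∈τ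
    ν = proj₁ z∝Q
    w∈⟨Q,w'⟩ : Span (Qv C) w' w
    w∈⟨Q,w'⟩ = ν , λ′ , λ i → begin
      w i                                   ≈⟨ solve 3 (λ x y l → x := (con (+ 1) :* x :+ :- l :* y) :+ l :* y)
                                                 refl (w i) (w' i) λ′ ⟩
      (1# * w i + - λ′ * w' i) + λ′ * w' i  ≈⟨ +-congʳ (proj₂ z∝Q i) ⟩
      ν * Qv C i + λ′ * w' i                ∎

  plane-code : V → Fin (q ℕ.* q)
  plane-code f = affine-code (f i₂) (f i₃) (f i₀) (f i₁)

  plane-code-injective : ∀ {f f' l} → ¬ ThroughL₀ f → ¬ ThroughL₀ f' → f i₀ ≈ l * f' i₀ → f i₁ ≈ l * f' i₁ →
    plane-code f ≡ plane-code f' → Proportional f f' l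
  plane-code-injective {l = l} τ⊉L₀ τ'⊉L₀ f₀≈ f₁≈ same =
    let (f₂≈ , f₃≈) = affine-code-injective τ⊉L₀ τ'⊉L₀ f₀≈ f₁≈ same
    in proportional-by-coordinates l f₀≈ f₁≈ f₂≈ f₃≈

  direction-of : ∀ C → Q∈L₀⊈τ C → V
  direction-of C (_ , τ⊉L₀) = proj₁ (h∖L₀ C τ⊉L₀)

  direction-of-off : ∀ C (c : Q∈L₀⊈τ C) → OffL₀On C (direction-of C c)
  direction-of-off C (_ , τ⊉L₀) = proj₂ (h∖L₀ C τ⊉L₀)

  code-same-point : ∀ C → Q∈L₀⊈τ C → Fin (suc q ℕ.* (q ℕ.* q))
  code-same-point C c = Fin.combine (pcode (w i₂) (w i₃)) (plane-code (τf C))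
    where
    w = direction-of C c

  code-same-point-injective : ∀ C D (c : Q∈L₀⊈τ C) (d : Q∈L₀⊈τ D) → pt C ≈ₚ pt D →
    code-same-point C c ≡ code-same-point D d → C ≈ᶜ D
  code-same-point-injective C D c@(Q∈L₀ , τ⊉L₀) d@(Q'∈L₀ , τ'⊉L₀) Q≈Q' same =
    Q≈Q' , ≈ₗ-by-direction C D c d (proj₂ Q≈Q') (proj₂ τ≈τ') w-off w'-off w∝w' , τ≈τ'
    where
    same-parts = FinP.combine-injective _ _ _ _ same
    Q∈τ' : τf D i₀ * Qv C i₀ + τf D i₁ * Qv C i₁ ≈ 0#
    Q∈τ' = ⊥₂-comm (⊥₂-* (proj₁ Q≈Q') (proj₂ Q≈Q' i₀) (proj₂ Q≈Q' i₁) (⊥₂-comm (Q∈τ₀₁ D Q'∈L₀)))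
    τ₀₁≈ = ⊥-common⇒proportional (τf D i₀) (τf D i₁) (τf C i₀) (τf C i₁)
      (onL₀-NonZero₂ Q∈L₀ (Qv≉0 C)) τ'⊉L₀
      (⊥₂-comm Q∈τ') (⊥₂-comm (Q∈τ₀₁ C Q∈L₀))
    τ≈τ' : pl C ≈π pl D
    τ≈τ' = proj₁ τ₀₁≈
      , plane-code-injective τ⊉L₀ τ'⊉L₀ (proj₁ (proj₂ τ₀₁≈)) (proj₂ (proj₂ τ₀₁≈)) (proj₂ same-parts)
    w-off = direction-of-off C c
    w'-off = direction-of-off D d
    w∝w' = pcode-injective (proj₁ w-off) (proj₁ w'-off) (proj₁ same-parts)

  SameDirection : Chamber → Chamber → Set
  SameDirection C D = ∃ λ w → ∃ λ w' → OffL₀On C w × OffL₀On D w' × Direction w' w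

  code-same-direction : ∀ C → Q∈L₀⊈τ C → Fin (suc q ℕ.* (q ℕ.* q))
  code-same-direction C _ = Fin.combine (pcode (τf C i₀) (τf C i₁)) (plane-code (τf C))

  code-same-direction-injective : ∀ C₀ → Q∈L₀⊈τ C₀ → ∀ C D (c : Q∈L₀⊈τ C) (d : Q∈L₀⊈τ D) →
    SameDirection C₀ C → SameDirection C₀ D → code-same-direction C c ≡ code-same-direction D d → C ≈ᶜ D
  code-same-direction-injective C₀ (Q₀∈L₀ , _) C D c@(Q∈L₀ , τ⊉L₀) d@(Q'∈L₀ , τ'⊉L₀)
    (w₀ , w , w₀-off , w-off , w∝w₀) (w₀' , w' , w₀'-off , w'-off , w'∝w₀') same =
    Q≈Q' , ≈ₗ-by-direction C D c d (proj₂ Q≈Q') (proj₂ τ≈τ') w-off w'-off w∝w' , τ≈τ'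
    where
    same-parts = FinP.combine-injective _ _ _ _ same
    τ₀₁≈ = pcode-injective τ⊉L₀ τ'⊉L₀ (proj₁ same-parts)
    τ≈τ' : pl C ≈π pl D
    τ≈τ' = proj₁ τ₀₁≈
      , plane-code-injective τ⊉L₀ τ'⊉L₀ (proj₁ (proj₂ τ₀₁≈)) (proj₂ (proj₂ τ₀₁≈)) (proj₂ same-parts)
    Q≈Q' : pt C ≈ₚ pt D
    Q≈Q' = τ∩L₀-unique (τf D) τ'⊉L₀ Q'∈L₀ Q∈L₀ (Qv≉0 D) (h⊆τ D (Q∈h D))
      (⊥-resp-≈π {pl C} {pl D} (Qv C) τ≈τ' (h⊆τ C (Q∈h C)))
    w∝w' : Direction w w'
    w∝w' = proportional₂-trans w∝w₀ (proportional₂-trans (direction-unique C₀ Q₀∈L₀ w₀'-off w₀-off)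
      (proportional₂-sym (proj₁ w'-off) w'∝w₀'))

  -- The lines h = ⟨Q, w⟩ and h' = ⟨Q', w'⟩ meet only if the parts of a common vector on w and w'
  -- agree in the coordinates 2, 3; with different directions it is a multiple of Q and of Q'.
  ¬opposite⇒same-direction : ∀ C E {w w'} → Q∈L₀⊈τ C → Q∈L₀⊈τ E → ¬ (pt C ≈ₚ pt E) →
    OffL₀On C w → OffL₀On E w' → ¬ Opposite C E → ¬ ¬ Direction w' w
  ¬opposite⇒same-direction C E {w} {w'} (Q∈L₀ , τ⊉L₀) (Q'∈L₀ , τ'⊉L₀) Q≉Q' w-off w'-off ¬opposite w'≁w =
    ¬opposite (Q∉τ' , disjoint , Q'∉τ)
    where
    Q∉τ' : ¬ (pt C ∈π pl E)
    Q∉τ' Q∈τ' = Q≉Q' (τ∩L₀-unique (τf E) τ'⊉L₀ Q'∈L₀ Q∈L₀ (Qv≉0 E) (h⊆τ E (Q∈h E)) Q∈τ')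
    Q'∉τ : ¬ (pt E ∈π pl C)
    Q'∉τ Q'∈τ =
      Q≉Q' (≈ₚ-sym {pt E} {pt C} (τ∩L₀-unique (τf C) τ⊉L₀ Q∈L₀ Q'∈L₀ (Qv≉0 C) (h⊆τ C (Q∈h C)) Q'∈τ))
    disjoint : Disjoint (ln C) (ln E)
    disjoint z z∈h z∈h' = by-a (a ≟ 0#)
      where
      z∈⟨Q,w⟩ = span-Q,w C Q∈L₀ w-off z∈h
      z∈⟨Q',w'⟩ = span-Q,w E Q'∈L₀ w'-off z∈h'
      a = proj₁ z∈⟨Q,w⟩
      b = proj₁ (proj₂ z∈⟨Q,w⟩)
      a' = proj₁ z∈⟨Q',w'⟩
      b' = proj₁ (proj₂ z∈⟨Q',w'⟩)
      z₂₃≈bw = span-Q,w₂₃ Q∈L₀ (proj₂ (proj₂ z∈⟨Q,w⟩))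
      z₂₃≈b'w' = span-Q,w₂₃ Q'∈L₀ (proj₂ (proj₂ z∈⟨Q',w'⟩))
      b'≈0 : b' ≈ 0#
      b'≈0 with b' ≟ 0#
      ... | yes b'≈0 = b'≈0
      ... | no b'≉0 =
        ⊥-elim (w'≁w (b' ⁻¹ * b , w'≈ (proj₁ z₂₃≈b'w') (proj₁ z₂₃≈bw) , w'≈ (proj₂ z₂₃≈b'w') (proj₂ z₂₃≈bw)))
        where
        w'≈ : ∀ {x y z} → z ≈ b' * x → z ≈ b * y → x ≈ b' ⁻¹ * b * y
        w'≈ {x} {y} z≈b'x z≈by =
          trans (sym (x⁻¹*[x*y]≈y x b'≉0)) (trans (*-congˡ (trans (sym z≈b'x) z≈by)) (sym (*-assoc _ _ _)))
      b≈0 : b ≈ 0#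
      b≈0 with b ≟ 0#
      ... | yes b≈0 = b≈0
      ... | no b≉0 = ⊥-elim (proj₁ w-off ( x*y≈0⇒y≈0 b≉0 (bw≈0 (proj₁ z₂₃≈bw) (proj₁ z₂₃≈b'w'))
                                         , x*y≈0⇒y≈0 b≉0 (bw≈0 (proj₂ z₂₃≈bw) (proj₂ z₂₃≈b'w'))))
        where
        bw≈0 : ∀ {x x' z} → z ≈ b * x → z ≈ b' * x' → b * x ≈ 0#
        bw≈0 z≈bx z≈b'x' = trans (sym z≈bx) (trans z≈b'x' (trans (*-congʳ b'≈0) (zeroˡ _)))
      drop-w : ∀ {a c x y z} → c ≈ 0# → z ≈ a * x + c * y → z ≈ a * x
      drop-w c≈0 z≈ = trans z≈ (trans (+-congˡ (trans (*-congʳ c≈0) (zeroˡ _))) (+-identityʳ _))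
      z≈aQ : Proportional z (Qv C) a
      z≈aQ i = drop-w b≈0 (proj₂ (proj₂ z∈⟨Q,w⟩) i)
      z≈a'Q' : Proportional z (Qv E) a'
      z≈a'Q' i = drop-w b'≈0 (proj₂ (proj₂ z∈⟨Q',w'⟩) i)
      by-a : Dec (a ≈ 0#) → IsZero z
      by-a (yes a≈0) i = trans (z≈aQ i) (trans (*-congʳ a≈0) (zeroˡ _))
      by-a (no a≉0) = ⊥-elim (Q≉Q' (a ⁻¹ * a' , λ i →
        trans (sym (x⁻¹*[x*y]≈y (Qv C i) a≉0)) (trans (*-congˡ (trans (sym (z≈aQ i)) (z≈a'Q' i))) (sym (*-assoc _ _ _)))))

  count-Q∈L₀⊈τ : ∀ (X : Chamber → Set) → PairwiseNonOpposite X →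
    ∀ cs → All (λ C → X C × Q∈L₀⊈τ C) cs → AllPairs (λ C D → ¬ (C ≈ᶜ D)) cs →
    length cs ≤ suc q ℕ.* (q ℕ.* q)
  count-Q∈L₀⊈τ X non-opposite = length≤-by-dichotomy (λ C → X C × Q∈L₀⊈τ C) (λ C D → pt C ≈ₚ pt D)
    (λ {C} {D} → ≈ₚ-sym {pt C} {pt D}) (λ {C} {D} {E} → ≈ₚ-trans {pt C} {pt D} {pt E}) SameDirection
    same-direction-as-itself direction-spreads bound-same-point bound-same-direction
    where
    same-direction-as-itself : ∀ {C} → X C × Q∈L₀⊈τ C → SameDirection C C
    same-direction-as-itself {C} (_ , c) =
      direction-of C c , direction-of C c , direction-of-off C c , direction-of-off C c , 1# , sym (*-identityˡ _) , sym (*-identityˡ _)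
    direction-spreads : ∀ {C D E} → X C × Q∈L₀⊈τ C → X D × Q∈L₀⊈τ D → X E × Q∈L₀⊈τ E → ¬ (pt D ≈ₚ pt E) →
      SameDirection C D → ¬ ¬ SameDirection C E
    direction-spreads {C} {D} {E} _ (X-D , d) (X-E , e) Q≉Q' (w₀ , w , w₀-off , w-off , w∝w₀) =
      ¬¬-map (λ w'∝w → w₀ , direction-of E e , w₀-off , direction-of-off E e , proportional₂-trans w'∝w w∝w₀)
        (¬opposite⇒same-direction D E d e Q≉Q' w-off (direction-of-off E e) (non-opposite D E X-D X-E))
    bound-same-point : ∀ C₀ → X C₀ × Q∈L₀⊈τ C₀ → ∀ cs → All (λ C → (X C × Q∈L₀⊈τ C) × pt C ≈ₚ pt C₀) cs →
      AllPairs (λ C D → ¬ (C ≈ᶜ D)) cs → length cs ≤ suc q ℕ.* (q ℕ.* q)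
    bound-same-point C₀ _ = length≤-by-code (λ C c → code-same-point C (proj₂ (proj₁ c)))
      (λ C D c d → code-same-point-injective C D (proj₂ (proj₁ c)) (proj₂ (proj₁ d))
        (≈ₚ-trans {pt C} {pt C₀} {pt D} (proj₂ c) (≈ₚ-sym {pt D} {pt C₀} (proj₂ d))))
    bound-same-direction : ∀ C₀ → X C₀ × Q∈L₀⊈τ C₀ → ∀ cs → All (λ C → (X C × Q∈L₀⊈τ C) × SameDirection C₀ C) cs →
      AllPairs (λ C D → ¬ (C ≈ᶜ D)) cs → length cs ≤ suc q ℕ.* (q ℕ.* q)
    bound-same-direction C₀ (_ , c₀) = length≤-by-code (λ C c → code-same-direction C (proj₂ (proj₁ c)))
      (λ C D c d → code-same-direction-injective C₀ c₀ C D (proj₂ (proj₁ c)) (proj₂ (proj₁ d)) (proj₂ c) (proj₂ d))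

  -- Reduction to L₀

  span-resp-generators : ∀ {x x' y y' w} → x ≐ x' → y ≐ y' → Span x y w → Span x' y' w
  span-resp-generators x≐x' y≐y' (a , b , w≐) =
    a , b , λ i → trans (w≐ i) (+-cong (*-congˡ (x≐x' i)) (*-congˡ (y≐y' i)))

  span-e₀e₁⇒onL₀ : ∀ {w} → Span (e i₀) (e i₁) w → OnL₀ w
  span-e₀e₁⇒onL₀ (a , b , w≐) = trans (w≐ i₂) (x*0+y*0≈0 a b) , trans (w≐ i₃) (x*0+y*0≈0 a b)

  module Standardise (ℓ : Line) where
    A : Automorphism
    A = proj₁ (standard-frame (Line.u ℓ) (Line.v ℓ) (Line.indep ℓ))

    open Automorphism A using (to)
    open Action A public

    u↦e₀ : to (Line.u ℓ) ≐ e i₀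
    u↦e₀ = proj₁ (proj₂ (standard-frame (Line.u ℓ) (Line.v ℓ) (Line.indep ℓ)))

    v↦e₁ : to (Line.v ℓ) ≐ e i₁
    v↦e₁ = proj₂ (proj₂ (standard-frame (Line.u ℓ) (Line.v ℓ) (Line.indep ℓ)))

    ∈ℓ⇒onL₀ : ∀ w → InSpan w ℓ → OnL₀ (to w)
    ∈ℓ⇒onL₀ _ w∈ℓ = span-e₀e₁⇒onL₀ (span-resp-generators u↦e₀ v↦e₁ (span-to w∈ℓ))

    onL₀⇒∈ℓ : ∀ w → OnL₀ (to w) → InSpan w ℓ
    onL₀⇒∈ℓ _ tw∈L₀ = span-to⁻ (span-resp-generators (≐-sym u↦e₀) (≐-sym v↦e₁) (onL₀-span tw∈L₀))

    form-to-e : ∀ f {x} j → to x ≐ e j → form-to f j ≈ dot f x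
    form-to-e f {x} j tx≐eⱼ =
      trans (sym (dot-e (form-to f) j)) (trans (dot-congʳ (form-to f) (≐-sym tx≐eⱼ)) (dot-form-to f x))

    ⊇ℓ⇒throughL₀ : ∀ π → ℓ ⊆π π → ThroughL₀ (form-to (Plane.form π))
    ⊇ℓ⇒throughL₀ π (f⊥u , f⊥v) =
      trans (form-to-e (Plane.form π) i₀ u↦e₀) f⊥u , trans (form-to-e (Plane.form π) i₁ v↦e₁) f⊥v

    throughL₀⇒⊇ℓ : ∀ π → ThroughL₀ (form-to (Plane.form π)) → ℓ ⊆π π
    throughL₀⇒⊇ℓ π (f'₀≈0 , f'₁≈0) =
      trans (sym (form-to-e (Plane.form π) i₀ u↦e₀)) f'₀≈0 , trans (sym (form-to-e (Plane.form π) i₁ v↦e₁)) f'₁≈0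

  Image : (Chamber → Chamber) → (Chamber → Set) → Chamber → Set
  Image f X D = ∃ λ C → X C × D ≡ f C

  at-most-Q∈ℓ⊆τ : ∀ (X : Chamber → Set) ℓ →
    AtMost (suc q ℕ.* (suc q ℕ.* suc q)) X (λ C → (pt C ∈ₗ ℓ) × (ℓ ⊆π pl C))
  at-most-Q∈ℓ⊆τ X ℓ cs _ = length≤-via-map chamber-to (λ {C} {D} → ≈ᶜ-to⁻ C D)
    (λ {C} (Q∈ℓ , ℓ⊆τ) → ∈ℓ⇒onL₀ (Qv C) Q∈ℓ , ⊇ℓ⇒throughL₀ (pl C) ℓ⊆τ) count-Q∈L₀⊆τ cs
    where
    open Standardise ℓ

  module _ (X : Chamber → Set) (non-opposite : PairwiseNonOpposite X) (ℓ : Line) where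
    open Standardise ℓ

    image-non-opposite : PairwiseNonOpposite (Image chamber-to X)
    image-non-opposite _ _ (C , X-C , ≡.refl) (D , X-D , ≡.refl) opposite =
      non-opposite C D X-C X-D (opposite-to⁻ C D opposite)

    at-most-Q∉ℓ⊆τ : AtMost (suc q ℕ.* (q ℕ.* q)) X (λ C → ¬ (pt C ∈ₗ ℓ) × (ℓ ⊆π pl C))
    at-most-Q∉ℓ⊆τ cs X-cs R-cs = length≤-via-map chamber-to (λ {C} {D} → ≈ᶜ-to⁻ C D)
      (λ {C} (X-C , Q∉ℓ , ℓ⊆τ) →
        (C , X-C , ≡.refl) , (λ Q∈L₀ → Q∉ℓ (onL₀⇒∈ℓ (Qv C) Q∈L₀)) , ⊇ℓ⇒throughL₀ (pl C) ℓ⊆τ)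
      (count-Q∉L₀⊆τ (Image chamber-to X) image-non-opposite) cs (All.zip (X-cs , R-cs))

    at-most-Q∈ℓ⊈τ : AtMost (suc q ℕ.* (q ℕ.* q)) X (λ C → (pt C ∈ₗ ℓ) × ¬ (ℓ ⊆π pl C))
    at-most-Q∈ℓ⊈τ cs X-cs R-cs = length≤-via-map chamber-to (λ {C} {D} → ≈ᶜ-to⁻ C D)
      (λ {C} (X-C , Q∈ℓ , ℓ⊈τ) →
        (C , X-C , ≡.refl) , ∈ℓ⇒onL₀ (Qv C) Q∈ℓ , (λ τ⊇L₀ → ℓ⊈τ (throughL₀⇒⊇ℓ (pl C) τ⊇L₀)))
      (count-Q∈L₀⊈τ (Image chamber-to X) image-non-opposite) cs (All.zip (X-cs , R-cs))

open import Data.Nat using (_+_; _*_; _^_)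

[q+1]^3≡ : ∀ q → suc q ℕ.* (suc q ℕ.* suc q) ≡ (q + 1) ^ 3
[q+1]^3≡ q =
  ≡.trans (≡.cong (λ m → suc q ℕ.* (suc q ℕ.* m)) (≡.sym (ℕP.*-identityʳ (suc q)))) (≡.cong (_^ 3) (ℕP.+-comm 1 q))

[q+1]*q^2≡ : ∀ q → suc q ℕ.* (q ℕ.* q) ≡ (q + 1) * q ^ 2
[q+1]*q^2≡ q =
  ≡.trans (≡.cong (λ m → suc q ℕ.* (q ℕ.* m)) (≡.sym (ℕP.*-identityʳ q))) (≡.cong (_* q ^ 2) (ℕP.+-comm 1 q))

lemma3p3 : (q : ℕ) (F : FiniteField q) → let open PG3 F in
    (X : Chamber → Set) → Maximal X → (ℓ : Line) →
    AtMost ((q + 1) ^ 3) X (λ C → (pt C ∈ₗ ℓ) × (ℓ ⊆π pl C))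
    × AtMost ((q + 1) * q ^ 2) X (λ C → ¬ (pt C ∈ₗ ℓ) × (ℓ ⊆π pl C))
    × AtMost ((q + 1) * q ^ 2) X (λ C → (pt C ∈ₗ ℓ) × ¬ (ℓ ⊆π pl C))
lemma3p3 q F X (non-opposite , _) ℓ =
    (λ cs X-cs R-cs distinct → ≤-cast ([q+1]^3≡ q) (at-most-Q∈ℓ⊆τ F X ℓ cs X-cs R-cs distinct))
  , (λ cs X-cs R-cs distinct → ≤-cast ([q+1]*q^2≡ q) (at-most-Q∉ℓ⊆τ F X non-opposite ℓ cs X-cs R-cs distinct))
  , (λ cs X-cs R-cs distinct → ≤-cast ([q+1]*q^2≡ q) (at-most-Q∈ℓ⊈τ F X non-opposite ℓ cs X-cs R-cs distinct))
  where
  ≤-cast : ∀ {k m n} → m ≡ n → k ≤ m → k ≤ n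
  ≤-cast ≡.refl k≤m = k≤m
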